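{- Let $N=RQ$ be a squarefree odd positive integer, with $R,Q$ positive integers. For $m,n\in\mathbb{Z}/(2N^2)\mathbb{Z}$ one has $$c_{R,Q}(\mathfrak{T}_N;m,n)=\mathrm{char}(m+n\equiv0 \bmod 2R)\,\mathrm{char}(m-n\equiv0\bmod 2Q)\sum_{\substack{R_1R_2=R\\ Q_1Q_2=Q}}\mu(R_1Q_1)\,\mathrm{char}\Big(\tfrac{m+n}{R}\equiv0\bmod R_1Q_1\Big)\,\mathrm{char}\Big(\tfrac{m-n}{2Q}\equiv0\bmod R_2Q_2\Big),$$ the sum being over factorizations into positive integers.
   Context: $\mathrm{char}(P)$ equals $1$ if $P$ holds and $0$ otherwise; $\mu$ is the Möbius function. For $j\ge1$ let $a(j)=\prod_{p\text{ prime},\,p|j}(1-p)$. For $j,s\in\mathbb{Z}/N\mathbb{Z}$ define $f_N(j,s)=\frac1N\sum_{k\bmod N}a(\gcd(j,k,N))\exp\left(\frac{2i\pi ks}{N}\right)$. For $m,n\in\mathbb{Z}/(2N^2)\mathbb{Z}$ define $c_{R,Q}(\mathfrak{T}_N;m,n)=\mathrm{char}(m+n\equiv0\bmod R,\ m-n\equiv0\bmod 2Q)\,f_N\!\left(\frac{m+n}{2R},\frac{m-n}{2Q}\right)$ (under these congruences $m+n$ is even and, $R$ being odd, both arguments are well defined in $\mathbb{Z}/N\mathbb{Z}$). -}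

module Defs where

open import Level using (Level)
open import Data.Nat as ℕ using (ℕ; zero; suc; NonZero)
open import Data.Nat.Properties using (m*n≢0)
open import Data.Nat.Divisibility using (_∣_; _∣?_)
open import Data.Nat.Primality using (Prime; prime?)
open import Data.Nat.GCD using (gcd)
open import Data.Integer as ℤ using (ℤ; +_; -[1+_]; ∣_∣)
open import Data.Integer.DivMod using (_/ℕ_; _%ℕ_)
open import Data.List using (List; []; _∷_; filter; upTo; foldr; length; cartesianProduct; map)
open import Data.List.Relation.Unary.Any using (any?)
open import Data.Product using (_×_; _,_; proj₁; proj₂)
import Data.Sum
open import Data.Bool using (if_then_else_)
open import Relation.Nullary using (Dec; yes; no; does; ¬_)
open import Relation.Nullary.Decidable using (_×-dec_)
open import Relation.Binary.PropositionalEquality using (_≡_)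
open import Algebra.Bundles using (CommutativeRing)

-- primes p ≤ j with p ∣ j  (for j ≥ 1 these are all prime divisors of j)
primeDivisors : ℕ → List ℕ
primeDivisors j = filter (λ p → prime? p ×-dec (p ∣? j)) (upTo (suc j))

a : ℕ → ℤ
a j = foldr (λ p acc → (ℤ.1ℤ ℤ.- + p) ℤ.* acc) ℤ.1ℤ (primeDivisors j)

μ : ℕ → ℤ
μ n = if does (any? (λ p → (p ℕ.* p) ∣? n) (primeDivisors n))
        then ℤ.0ℤ
        else (ℤ.-1ℤ ℤ.^ length (primeDivisors n))

charℤ : ∀ {p} {P : Set p} → Dec P → ℤ
charℤ d = if does d then ℤ.1ℤ else ℤ.0ℤ

factorizations : ℕ → List (ℕ × ℕ)
factorizations n =
  filter (λ xy → (proj₁ xy ℕ.* proj₂ xy) ℕ.≟ n) (cartesianProduct (upTo (suc n)) (upTo (suc n)))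

sumℤ : List ℤ → ℤ
sumℤ = foldr ℤ._+_ ℤ.0ℤ

SquareFree : ℕ → Set
SquareFree n = ∀ d → (d ℕ.* d) ∣ n → d ≡ 1

-- divisibility of an integer by a natural number: d ∣ x  iff  d ∣ |x|
-- (this is how Data.Integer.Divisibility defines _∣_)
_∣ℤ?_ : (d : ℕ) (x : ℤ) → Dec (d ∣ ∣ x ∣)
d ∣ℤ? x = d ∣? ∣ x ∣

rhs : (R Q : ℕ) .{{_ : NonZero R}} .{{_ : NonZero Q}} → ℤ → ℤ → ℤ
rhs R Q m n =
  charℤ ((2 ℕ.* R) ∣ℤ? (m ℤ.+ n)) ℤ.* charℤ ((2 ℕ.* Q) ∣ℤ? (m ℤ.- n)) ℤ.*
  sumℤ (map (λ r → sumℤ (map (λ q → term (proj₁ r) (proj₂ r) (proj₁ q) (proj₂ q))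
                           (factorizations Q)))
            (factorizations R))
  where
  instance _ = m*n≢0 2 Q
  term : ℕ → ℕ → ℕ → ℕ → ℤ
  term R₁ R₂ Q₁ Q₂ =
    μ (R₁ ℕ.* Q₁) ℤ.*
    charℤ ((R₁ ℕ.* Q₁) ∣ℤ? ((m ℤ.+ n) /ℕ R)) ℤ.*
    charℤ ((R₂ ℕ.* Q₂) ∣ℤ? ((m ℤ.- n) /ℕ (2 ℕ.* Q)))

-- Exponential sums, with values in a commutative ring K containing a
-- primitive N-th root of unity ζ (standing in for exp(2iπ/N) ∈ ℂ)
-- and an inverse Ninv of N.

module Over {c ℓ : Level} (K : CommutativeRing c ℓ) where
  open CommutativeRing K

  ιℕ : ℕ → Carrier
  ιℕ zero = 0#
  ιℕ (suc k) = 1# + ιℕ k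

  ι : ℤ → Carrier
  ι (+ k) = ιℕ k
  ι -[1+ k ] = - ιℕ (suc k)

  pow : Carrier → ℕ → Carrier
  pow x zero = 1#
  pow x (suc k) = x * pow x k

  sumK : List Carrier → Carrier
  sumK = foldr _+_ 0#

  charK : ∀ {p} {P : Set p} → Dec P → Carrier
  charK d = if does d then 1# else 0#

  f : (N : ℕ) .{{_ : NonZero N}} (ζ Ninv : Carrier) → ℤ → ℤ → Carrier
  f N ζ Ninv j s =
    Ninv * sumK (map (λ k → ι (a (gcd ∣ j ∣ (gcd k N))) * pow ζ (k ℕ.* (s %ℕ N))) (upTo N))

  c-RQ : (R Q : ℕ) .{{_ : NonZero R}} .{{_ : NonZero Q}} (ζ Ninv : Carrier) → ℤ → ℤ → Carrier
  c-RQ R Q ζ Ninv m n =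
    charK (R ∣ℤ? (m ℤ.+ n)) * charK ((2 ℕ.* Q) ∣ℤ? (m ℤ.- n)) *
    f (R ℕ.* Q) ζ Ninv ((m ℤ.+ n) /ℕ (2 ℕ.* R)) ((m ℤ.- n) /ℕ (2 ℕ.* Q))
    where
    instance _ = m*n≢0 R Q
    instance _ = m*n≢0 2 R
    instance _ = m*n≢0 2 Q

  PrimitiveRoot : ℕ → Carrier → Set ℓ
  PrimitiveRoot N ζ = (pow ζ N ≈ 1#) × (∀ d → 0 ℕ.< d → d ℕ.< N → ¬ (pow ζ d ≈ 1#))

  NoZeroDivisors : Set (Level._⊔_ c ℓ)
  NoZeroDivisors = ∀ x y → x * y ≈ 0# → (x ≈ 0#) Data.Sum.⊎ (y ≈ 0#)

  IsInverseOf : ℕ → Carrier → Set ℓ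
  IsInverseOf N Ninv = ι (+ N) * Ninv ≈ 1#

{-# OPTIONS --safe #-}
-- Möbius inversion a(g) = Σ_{e ∣ g} μ(e) e (g squarefree) turns f_N(j, s) into a sum over e ∣ gcd(j, N)
-- of μ(e) e/N times Σ_{k < N, e ∣ k} ζ^{ks}, a geometric sum equal to N/e if N ∣ e s and to 0 otherwise;
-- so f_N(j, s) = Σ_{e ∣ gcd(j, N), N ∣ e s} μ(e). On the other side, as R and Q are coprime, the pairs
-- R₁ ∣ R, Q₁ ∣ Q correspond to the divisors d = R₁ Q₁ of N, with R₂ Q₂ = N / d. Under the congruence
-- conditions (m + n)/R = 2j, so R₁ Q₁ ∣ (m + n)/R iff d ∣ j as N is odd, and R₂ Q₂ ∣ s iff N ∣ d s.
module Submission where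

open import Level using (Level; 0ℓ)
open import Function using (_∘_; id)
open import Function.Bundles using (_⇔_; mk⇔; Equivalence)
open import Algebra.Bundles using (CommutativeMonoid; CommutativeRing)
open import Data.Bool using (true; false; if_then_else_)
open import Data.Product using (_×_; _,_; proj₁; proj₂)
open import Data.Sum using (inj₁; inj₂)
open import Data.Sign as Sign using (Sign)
open import Data.Nat as ℕ using (ℕ; zero; suc; z≤n; s≤s; _<_; _≤_; NonZero)
import Data.Nat.Properties as ℕP
open import Data.Nat.Divisibility
  using (_∣_; _∣?_; divides; ∣-refl; ∣-trans; ∣-antisym; ∣⇒≤; 0∣⇒≡0; m∣m*n; n∣m*n; ∣n⇒∣m*n; ∣m⇒∣m*n; ∣m+n∣m⇒∣n;
         *-monoʳ-∣; *-monoˡ-∣; *-pres-∣; *-cancelˡ-∣; *-cancelʳ-∣; m%n≡0⇒n∣m)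
open import Data.Nat.DivMod using (_%_; _/_; m≡m%n+[m/n]*n; m%n<n)
open import Data.Nat.GCD using (gcd; gcd[m,n]∣m; gcd[m,n]∣n; gcd-greatest; c*gcd[m,n]≡gcd[cm,cn])
open import Data.Nat.LCM using (lcm; lcm-least; gcd*lcm)
open import Data.Nat.Coprimality as Cop using (Coprime; coprime-divisor; coprime⇒gcd≡1)
open import Data.Nat.Primality
  using (Prime; prime?; ¬prime[1]; prime[2]; prime⇒nonZero; prime⇒irreducible; euclidsLemma; productOfPrimes≢0)
open import Data.Nat.Primality.Factorisation using (PrimeFactorisation; factorise)
open import Data.Nat.ListAction using (product)
open import Data.Nat.Tactic.RingSolver using () renaming (solve-∀ to solveℕ)
open import Data.Integer as ℤ using (ℤ; +_; -[1+_])
import Data.Integer.Properties as ℤP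
open import Data.Integer.DivMod using (_%ℕ_; _/ℕ_; a≡a%ℕn+[a/ℕn]*n; n%ℕd<d)
open import Data.Integer.Tactic.RingSolver using () renaming (solve-∀ to solveℤ)
open import Data.List using (List; []; _∷_; _++_; foldr; map; filter; length; applyUpTo; upTo; cartesianProduct)
open import Data.List.Properties using (map-++; map-∘; map-cong-local)
open import Data.List.Relation.Unary.Any using (any?)
open import Data.List.Relation.Unary.All as All using (All; []; _∷_; lookupAny)
open import Data.List.Relation.Unary.All.Properties using (all-filter)
open import Relation.Unary using (Pred; Decidable)
open import Relation.Binary.PropositionalEquality as ≡ using (_≡_; _≢_)
open import Relation.Nullary using (¬_; Dec; yes; no; does; contradiction)
open import Relation.Nullary.Decidable using (_×-dec_; dec-true; dec-false)
open import Defs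

module RangeFold {c ℓ} (M : CommutativeMonoid c ℓ) where
  open CommutativeMonoid M
  open import Algebra.Properties.CommutativeSemigroup commutativeSemigroup using (interchange)
  open import Relation.Binary.Reasoning.Setoid setoid

  fold : ℕ → (ℕ → Carrier) → Carrier
  fold zero    F = ε
  fold (suc n) F = F 0 ∙ fold n (F ∘ suc)

  fold-applyUpTo : ∀ n g (F : ℕ → Carrier) →
    foldr _∙_ ε (map F (applyUpTo g n)) ≡ fold n (F ∘ g)
  fold-applyUpTo zero    g F = ≡.refl
  fold-applyUpTo (suc n) g F = ≡.cong (F (g 0) ∙_) (fold-applyUpTo n (g ∘ suc) F)

  fold-upTo : ∀ n F → foldr _∙_ ε (map F (upTo n)) ≡ fold n F
  fold-upTo n F = fold-applyUpTo n id F

  fold-cong : ∀ n {F G : ℕ → Carrier} → (∀ i → i < n → F i ≈ G i) → fold n F ≈ fold n G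
  fold-cong zero    F≈G = refl
  fold-cong (suc n) F≈G = ∙-cong (F≈G 0 (s≤s z≤n)) (fold-cong n (λ i i<n → F≈G (suc i) (s≤s i<n)))

  fold-ε : ∀ n F → (∀ i → i < n → F i ≈ ε) → fold n F ≈ ε
  fold-ε zero    F F≈ε = refl
  fold-ε (suc n) F F≈ε =
    trans (∙-cong (F≈ε 0 (s≤s z≤n)) (fold-ε n _ (λ i i<n → F≈ε (suc i) (s≤s i<n)))) (identityˡ ε)

  fold-∙ : ∀ n F G → fold n (λ i → F i ∙ G i) ≈ fold n F ∙ fold n G
  fold-∙ zero    F G = sym (identityˡ ε)
  fold-∙ (suc n) F G = trans (∙-cong refl (fold-∙ n _ _)) (interchange _ _ _ _)

  fold-swap : ∀ m n (F : ℕ → ℕ → Carrier) →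
    fold m (λ i → fold n (F i)) ≈ fold n (λ j → fold m (λ i → F i j))
  fold-swap zero    n F = sym (fold-ε n _ (λ _ _ → refl))
  fold-swap (suc m) n F = trans (∙-cong refl (fold-swap m n (F ∘ suc))) (sym (fold-∙ n _ _))

  fold-+ : ∀ m n F → fold (m ℕ.+ n) F ≈ fold m F ∙ fold n (λ i → F (m ℕ.+ i))
  fold-+ zero    n F = sym (identityˡ _)
  fold-+ (suc m) n F = trans (∙-cong refl (fold-+ m n (F ∘ suc))) (sym (assoc _ _ _))

  fold-single : ∀ n F c → c < n → (∀ i → i < n → i ≢ c → F i ≈ ε) → fold n F ≈ F c
  fold-single (suc n) F zero c<n F≈ε =
    trans (∙-cong refl (fold-ε n _ (λ i i<n → F≈ε (suc i) (s≤s i<n) (λ ())))) (identityʳ _)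
  fold-single (suc n) F (suc c) (s≤s c<n) F≈ε =
    trans (∙-cong (F≈ε 0 (s≤s z≤n) (λ ()))
                  (fold-single n _ c c<n (λ i i<n i≢c → F≈ε (suc i) (s≤s i<n) (i≢c ∘ ℕP.suc-injective))))
          (identityˡ _)

  fold-extend : ∀ m n F → m ≤ n → (∀ i → m ≤ i → F i ≈ ε) → fold n F ≈ fold m F
  fold-extend m n F m≤n F≈ε = begin
    fold n F                                      ≡⟨ ≡.cong (λ k → fold k F) (≡.sym (ℕP.m+[n∸m]≡n m≤n)) ⟩
    fold (m ℕ.+ (n ℕ.∸ m)) F                      ≈⟨ fold-+ m (n ℕ.∸ m) F ⟩
    fold m F ∙ fold (n ℕ.∸ m) (λ i → F (m ℕ.+ i)) ≈⟨ ∙-cong refl (fold-ε (n ℕ.∸ m) _ (λ i _ → F≈ε (m ℕ.+ i) (ℕP.m≤m+n m i))) ⟩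
    fold m F ∙ ε                                  ≈⟨ identityʳ _ ⟩
    fold m F                                      ∎

  fold-last : ∀ n F → fold (suc n) F ≈ fold n F ∙ F n
  fold-last zero    F = comm _ _
  fold-last (suc n) F = trans (∙-cong refl (fold-last n (F ∘ suc))) (sym (assoc _ _ _))

  fold-multiples : ∀ e M (F : ℕ → Carrier) .{{_ : NonZero e}} → (∀ k → ¬ e ∣ k → F k ≈ ε) →
    fold (e ℕ.* M) F ≈ fold M (λ t → F (e ℕ.* t))
  fold-multiples e zero F F≈ε = reflexive (≡.cong (λ k → fold k F) (ℕP.*-zeroʳ e))
  fold-multiples e (suc M) F F≈ε = begin
    fold (e ℕ.* suc M) F
      ≡⟨ ≡.cong (λ k → fold k F) (ℕP.*-suc e M) ⟩
    fold (e ℕ.+ e ℕ.* M) F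
      ≈⟨ fold-+ e (e ℕ.* M) F ⟩
    fold e F ∙ fold (e ℕ.* M) (λ i → F (e ℕ.+ i))
      ≈⟨ ∙-cong (fold-single e F 0 (ℕ.>-nonZero⁻¹ e) (λ i i<e i≢0 → F≈ε i (λ e∣i → ℕP.<⇒≱ i<e (∣⇒≤ {{ℕ.≢-nonZero i≢0}} e∣i))))
                (fold-multiples e M _ (λ k ¬e∣k → F≈ε (e ℕ.+ k) (λ e∣e+k → ¬e∣k (∣m+n∣m⇒∣n e∣e+k ∣-refl)))) ⟩
    F 0 ∙ fold M (λ t → F (e ℕ.+ e ℕ.* t))
      ≈⟨ ∙-cong (reflexive (≡.cong F (≡.sym (ℕP.*-zeroʳ e)))) (fold-cong M (λ t _ → reflexive (≡.cong F (≡.sym (ℕP.*-suc e t))))) ⟩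
    fold (suc M) (λ t → F (e ℕ.* t))
      ∎

module RangeSum {c ℓ} (R : CommutativeRing c ℓ) where
  open CommutativeRing R
  open RangeFold +-commutativeMonoid public

  *-distribˡ-fold : ∀ n x F → x * fold n F ≈ fold n (λ i → x * F i)
  *-distribˡ-fold zero    x F = zeroʳ x
  *-distribˡ-fold (suc n) x F = trans (distribˡ x _ _) (+-cong refl (*-distribˡ-fold n x (F ∘ suc)))

  *-distribʳ-fold : ∀ n x F → fold n F * x ≈ fold n (λ i → F i * x)
  *-distribʳ-fold n x F =
    trans (*-comm _ x) (trans (*-distribˡ-fold n x F) (fold-cong n (λ i _ → *-comm x (F i))))

  *-fold-swap : ∀ m n (x : ℕ → Carrier) (F : ℕ → ℕ → Carrier) →
    fold m (λ i → x i * fold n (F i)) ≈ fold n (λ j → fold m (λ i → x i * F i j))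
  *-fold-swap m n x F = trans (fold-cong m (λ i _ → *-distribˡ-fold n (x i) (F i))) (fold-swap m n _)

module ∑ℤ = RangeSum ℤP.+-*-commutativeRing
module ∏ℤ = RangeFold ℤP.*-1-commutativeMonoid

module Indicator {c ℓ} (K : CommutativeRing c ℓ) where
  open CommutativeRing K
  open Over K using (charK)

  private variable
    p q r : Level
    A : Set p
    B : Set q
    C : Set r

  charK-yes : (d : Dec A) → A → charK d ≈ 1#
  charK-yes (yes _) _ = refl
  charK-yes (no ¬a) a = contradiction a ¬a

  charK-no : (d : Dec A) → ¬ A → charK d ≈ 0#
  charK-no (yes a) ¬a = contradiction a ¬a
  charK-no (no _)  _  = refl

  charK-*-cong : (d : Dec A) {x y : Carrier} → (A → x ≈ y) → charK d * x ≈ charK d * y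
  charK-*-cong (yes a) x≈y = *-cong refl (x≈y a)
  charK-*-cong (no _)  x≈y = trans (zeroˡ _) (sym (zeroˡ _))

  charK-cong : (d : Dec A) (d′ : Dec B) → A ⇔ B → charK d ≈ charK d′
  charK-cong (yes _) (yes _) _   = refl
  charK-cong (no _)  (no _)  _   = refl
  charK-cong (yes a) (no ¬b) A⇔B = contradiction (Equivalence.to A⇔B a) ¬b
  charK-cong (no ¬a) (yes b) A⇔B = contradiction (Equivalence.from A⇔B b) ¬a

  charK-cong-* : (d : Dec A) (d′ : Dec B) (e : Dec C) → (C → A ⇔ B) → charK d * charK e ≈ charK d′ * charK e
  charK-cong-* d d′ (yes c) A⇔B = *-cong (charK-cong d d′ (A⇔B c)) refl
  charK-cong-* d d′ (no _)  A⇔B = trans (zeroʳ _) (sym (zeroʳ _))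

  charK-*-*-cong : (d : Dec A) (x : Carrier) {y z : Carrier} → (A → y ≈ z) → charK d * x * y ≈ charK d * x * z
  charK-*-*-cong (yes a) x y≈z = *-cong refl (y≈z a)
  charK-*-*-cong (no _)  x y≈z = trans (*-cong (zeroˡ x) refl) (trans (zeroˡ _) (sym (trans (*-cong (zeroˡ x) refl) (zeroˡ _))))

  charK-× : (d : Dec C) (d₁ : Dec A) (d₂ : Dec B) → C ⇔ (A × B) → charK d ≈ charK d₁ * charK d₂
  charK-× d (yes a) (yes b) C⇔A×B = trans (charK-yes d (Equivalence.from C⇔A×B (a , b))) (sym (*-identityˡ 1#))
  charK-× d (no ¬a) d₂      C⇔A×B = trans (charK-no d (¬a ∘ proj₁ ∘ Equivalence.to C⇔A×B)) (sym (zeroˡ _))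
  charK-× d (yes _) (no ¬b) C⇔A×B = trans (charK-no d (¬b ∘ proj₂ ∘ Equivalence.to C⇔A×B)) (sym (zeroʳ _))

module IntegerEmbedding {c ℓ} (K : CommutativeRing c ℓ) where
  open CommutativeRing K
  open Over K using (ιℕ; ι; charK)
  open import Algebra.Definitions.RawMonoid +-rawMonoid using () renaming (_×_ to _×ₙ_)
  open import Algebra.Properties.Semiring.Mult semiring using (×-homo-+; ×1-homo-*)
  open import Algebra.Properties.Ring ring using (-0#≈0#; -1*x≈-x; -‿involutive; -‿distribˡ-*; -‿+-comm)
  open import Algebra.Properties.CommutativeSemigroup *-commutativeSemigroup using (interchange)
  open import Algebra.Properties.CommutativeSemigroup +-commutativeSemigroup using () renaming (interchange to +-interchange)
  open import Relation.Binary.Reasoning.Setoid setoid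
  open RangeSum K using (fold)

  ιℕ≡×1# : ∀ n → ιℕ n ≡ n ×ₙ 1#
  ιℕ≡×1# zero    = ≡.refl
  ιℕ≡×1# (suc n) = ≡.cong (_+_ 1#) (ιℕ≡×1# n)

  ιℕ-+ : ∀ m n → ιℕ (m ℕ.+ n) ≈ ιℕ m + ιℕ n
  ιℕ-+ m n rewrite ιℕ≡×1# (m ℕ.+ n) | ιℕ≡×1# m | ιℕ≡×1# n = ×-homo-+ 1# m n

  ιℕ-* : ∀ m n → ιℕ (m ℕ.* n) ≈ ιℕ m * ιℕ n
  ιℕ-* m n rewrite ιℕ≡×1# (m ℕ.* n) | ιℕ≡×1# m | ιℕ≡×1# n = ×1-homo-* m n

  ι-⊖ : ∀ m n → ι (m ℤ.⊖ n) ≈ ιℕ m - ιℕ n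
  ι-⊖ m       zero    = sym (trans (+-cong refl -0#≈0#) (+-identityʳ _))
  ι-⊖ zero    (suc n) = sym (+-identityˡ _)
  ι-⊖ (suc m) (suc n) = begin
    ι (suc m ℤ.⊖ suc n)              ≡⟨ ≡.cong ι (ℤP.[1+m]⊖[1+n]≡m⊖n m n) ⟩
    ι (m ℤ.⊖ n)                      ≈⟨ ι-⊖ m n ⟩
    ιℕ m - ιℕ n                      ≈⟨ sym (+-identityˡ _) ⟩
    0# + (ιℕ m - ιℕ n)               ≈⟨ +-cong (sym (-‿inverseʳ 1#)) refl ⟩
    (1# - 1#) + (ιℕ m - ιℕ n)        ≈⟨ +-interchange _ _ _ _ ⟩
    (1# + ιℕ m) + (- 1# + - ιℕ n)    ≈⟨ +-cong refl (-‿+-comm 1# (ιℕ n)) ⟩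
    (1# + ιℕ m) - (1# + ιℕ n)        ∎

  ι-+ : ∀ x y → ι (x ℤ.+ y) ≈ ι x + ι y
  ι-+ (+ m)    (+ n)    = ιℕ-+ m n
  ι-+ (+ m)    -[1+ n ] = ι-⊖ m (suc n)
  ι-+ -[1+ m ] (+ n)    = trans (ι-⊖ n (suc m)) (+-comm _ _)
  ι-+ -[1+ m ] -[1+ n ] = begin
    - (1# + (1# + ιℕ (m ℕ.+ n)))    ≈⟨ -‿cong (+-cong refl (+-cong refl (ιℕ-+ m n))) ⟩
    - (1# + (1# + (ιℕ m + ιℕ n)))   ≈⟨ -‿cong (sym (+-assoc 1# 1# _)) ⟩
    - ((1# + 1#) + (ιℕ m + ιℕ n))   ≈⟨ -‿cong (+-interchange _ _ _ _) ⟩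
    - ((1# + ιℕ m) + (1# + ιℕ n))   ≈⟨ sym (-‿+-comm _ _) ⟩
    - (1# + ιℕ m) + - (1# + ιℕ n)   ∎

  signK : Sign → Carrier
  signK Sign.+ = 1#
  signK Sign.- = - 1#

  signK-* : ∀ s t → signK (s Sign.* t) ≈ signK s * signK t
  signK-* Sign.+ t      = sym (*-identityˡ _)
  signK-* Sign.- Sign.+ = sym (*-identityʳ _)
  signK-* Sign.- Sign.- = trans (sym (-‿involutive 1#)) (sym (-1*x≈-x (- 1#)))

  ι-◃ : ∀ s n → ι (s ℤ.◃ n) ≈ signK s * ιℕ n
  ι-◃ s      zero    = sym (zeroʳ _)
  ι-◃ Sign.+ (suc n) = sym (*-identityˡ _)
  ι-◃ Sign.- (suc n) = trans (-‿cong (sym (*-identityˡ _))) (-‿distribˡ-* 1# _)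

  ι-* : ∀ x y → ι (x ℤ.* y) ≈ ι x * ι y
  ι-* x y = begin
    ι (x ℤ.* y)
      ≈⟨ ι-◃ (ℤ.sign x Sign.* ℤ.sign y) (ℤ.∣ x ∣ ℕ.* ℤ.∣ y ∣) ⟩
    signK (ℤ.sign x Sign.* ℤ.sign y) * ιℕ (ℤ.∣ x ∣ ℕ.* ℤ.∣ y ∣)
      ≈⟨ *-cong (signK-* (ℤ.sign x) (ℤ.sign y)) (ιℕ-* ℤ.∣ x ∣ ℤ.∣ y ∣) ⟩
    (signK (ℤ.sign x) * signK (ℤ.sign y)) * (ιℕ ℤ.∣ x ∣ * ιℕ ℤ.∣ y ∣)
      ≈⟨ interchange _ _ _ _ ⟩
    (signK (ℤ.sign x) * ιℕ ℤ.∣ x ∣) * (signK (ℤ.sign y) * ιℕ ℤ.∣ y ∣)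
      ≈⟨ sym (*-cong (ι-sign-abs x) (ι-sign-abs y)) ⟩
    ι x * ι y
      ∎
    where
    ι-sign-abs : ∀ x → ι x ≈ signK (ℤ.sign x) * ιℕ ℤ.∣ x ∣
    ι-sign-abs x = trans (reflexive (≡.cong ι (≡.sym (ℤP.◃-inverse x)))) (ι-◃ (ℤ.sign x) ℤ.∣ x ∣)

  ι-fold : ∀ n F → ι (∑ℤ.fold n F) ≈ fold n (ι ∘ F)
  ι-fold zero    F = refl
  ι-fold (suc n) F = trans (ι-+ (F 0) _) (+-cong refl (ι-fold n (F ∘ suc)))

  ι-charℤ : ∀ {p} {A : Set p} (d : Dec A) → ι (charℤ d) ≈ charK d
  ι-charℤ (yes _) = +-identityʳ 1#
  ι-charℤ (no _)  = refl

  ι-charℤ-*-charℤ-* : ∀ {p q} {A : Set p} {B : Set q} (d : Dec A) (e : Dec B) x →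
    ι (charℤ d ℤ.* charℤ e ℤ.* x) ≈ charK d * charK e * ι x
  ι-charℤ-*-charℤ-* d e x =
    trans (ι-* (charℤ d ℤ.* charℤ e) x) (*-cong (trans (ι-* (charℤ d) (charℤ e)) (*-cong (ι-charℤ d) (ι-charℤ e))) refl)

module RootsOfUnity {c ℓ} (K : CommutativeRing c ℓ) where
  open CommutativeRing K
  open Over K using (ιℕ; pow; charK; PrimitiveRoot; NoZeroDivisors)
  open import Algebra.Definitions.RawMonoid *-rawMonoid using () renaming (_×_ to _^ₘ_)
  open import Algebra.Properties.Semiring.Exp semiring using (^-homo-*; ^-assocʳ; ^-congˡ)
  open import Algebra.Properties.Ring ring using (x∙y⁻¹≈ε⇒x≈y; +-cancelʳ; [y-z]x≈yx-zx)
  open import Relation.Binary.Reasoning.Setoid setoid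
  open RangeSum K
  open Indicator K
  open IntegerEmbedding K using (ιℕ-*)

  pow≡^ : ∀ x n → pow x n ≡ n ^ₘ x
  pow≡^ x zero    = ≡.refl
  pow≡^ x (suc n) = ≡.cong (x *_) (pow≡^ x n)

  pow-+ : ∀ x m n → pow x (m ℕ.+ n) ≈ pow x m * pow x n
  pow-+ x m n rewrite pow≡^ x (m ℕ.+ n) | pow≡^ x m | pow≡^ x n = ^-homo-* x m n

  pow-* : ∀ x m n → pow x (m ℕ.* n) ≈ pow (pow x m) n
  pow-* x m n rewrite pow≡^ x (m ℕ.* n) | pow≡^ (pow x m) n | pow≡^ x m = sym (^-assocʳ x m n)

  pow-congˡ : ∀ {x y} n → x ≈ y → pow x n ≈ pow y n
  pow-congˡ {x} {y} n x≈y rewrite pow≡^ x n | pow≡^ y n = ^-congˡ n x≈y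

  pow-1# : ∀ n → pow 1# n ≈ 1#
  pow-1# zero    = refl
  pow-1# (suc n) = trans (*-identityˡ _) (pow-1# n)

  pow≈1-multiple : ∀ {x} N q → pow x N ≈ 1# → pow x (q ℕ.* N) ≈ 1#
  pow≈1-multiple {x} N q x^N≈1 = begin
    pow x (q ℕ.* N)    ≡⟨ ≡.cong (pow x) (ℕP.*-comm q N) ⟩
    pow x (N ℕ.* q)    ≈⟨ pow-* x N q ⟩
    pow (pow x N) q    ≈⟨ pow-congˡ q x^N≈1 ⟩
    pow 1# q           ≈⟨ pow-1# q ⟩
    1#                 ∎

  module _ {N ζ} .{{_ : NonZero N}} (prim : PrimitiveRoot N ζ) where

    primitive-pow≈1⇒∣ : ∀ x → pow ζ x ≈ 1# → N ∣ x
    primitive-pow≈1⇒∣ x ζ^x≈1 with x % N in x%N≡r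
    ... | zero  = m%n≡0⇒n∣m x N x%N≡r
    ... | suc r = contradiction ζ^[1+r]≈1 (proj₂ prim (suc r) (s≤s z≤n) (≡.subst (_< N) x%N≡r (m%n<n x N)))
      where
      ζ^[1+r]≈1 : pow ζ (suc r) ≈ 1#
      ζ^[1+r]≈1 = begin
        pow ζ (suc r)                                   ≈⟨ sym (*-identityʳ _) ⟩
        pow ζ (suc r) * 1#                              ≈⟨ *-cong refl (sym (pow≈1-multiple N (x / N) (proj₁ prim))) ⟩
        pow ζ (suc r) * pow ζ (x / N ℕ.* N)             ≈⟨ sym (pow-+ ζ (suc r) _) ⟩
        pow ζ (suc r ℕ.+ x / N ℕ.* N)                   ≡⟨ ≡.cong (λ i → pow ζ (i ℕ.+ x / N ℕ.* N)) x%N≡r ⟨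
        pow ζ (x % N ℕ.+ x / N ℕ.* N)                   ≡⟨ ≡.cong (pow ζ) (m≡m%n+[m/n]*n x N) ⟨
        pow ζ x                                         ≈⟨ ζ^x≈1 ⟩
        1#                                              ∎

    primitive-∣⇒pow≈1 : ∀ x → N ∣ x → pow ζ x ≈ 1#
    primitive-∣⇒pow≈1 x (divides q ≡.refl) = pow≈1-multiple N q (proj₁ prim)

  fold-1#≈ιℕ : ∀ n → fold n (λ _ → 1#) ≈ ιℕ n
  fold-1#≈ιℕ zero    = refl
  fold-1#≈ιℕ (suc n) = +-cong refl (fold-1#≈ιℕ n)

  fold-pow≈ιℕ : ∀ {ω} M → ω ≈ 1# → fold M (pow ω) ≈ ιℕ M
  fold-pow≈ιℕ M ω≈1 = trans (fold-cong M (λ i _ → trans (pow-congˡ i ω≈1) (pow-1# i))) (fold-1#≈ιℕ M)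

  ω*fold-pow+1≈fold-pow+pow : ∀ ω M → ω * fold M (pow ω) + 1# ≈ fold M (pow ω) + pow ω M
  ω*fold-pow+1≈fold-pow+pow ω M = begin
    ω * fold M (pow ω) + 1#                  ≈⟨ +-comm _ _ ⟩
    1# + ω * fold M (pow ω)                  ≈⟨ +-cong refl (*-distribˡ-fold M ω (pow ω)) ⟩
    fold (suc M) (pow ω)                     ≈⟨ fold-last M (pow ω) ⟩
    fold M (pow ω) + pow ω M                 ∎

  geometric-sum≈0 : NoZeroDivisors → ∀ {ω} M → pow ω M ≈ 1# → ¬ ω ≈ 1# → fold M (pow ω) ≈ 0#
  geometric-sum≈0 nzd {ω} M ω^M≈1 ω≉1 with nzd (ω - 1#) S [ω-1]S≈0
    where
    S = fold M (pow ω)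
    ωS≈S : ω * S ≈ S
    ωS≈S = +-cancelʳ 1# _ _ (trans (ω*fold-pow+1≈fold-pow+pow ω M) (+-cong refl ω^M≈1))
    [ω-1]S≈0 : (ω - 1#) * S ≈ 0#
    [ω-1]S≈0 = begin
      (ω - 1#) * S       ≈⟨ [y-z]x≈yx-zx S ω 1# ⟩
      ω * S - 1# * S     ≈⟨ +-cong ωS≈S (-‿cong (*-identityˡ S)) ⟩
      S - S              ≈⟨ -‿inverseʳ S ⟩
      0#                 ∎
  ... | inj₁ ω-1≈0 = contradiction (x∙y⁻¹≈ε⇒x≈y ω 1# ω-1≈0) ω≉1
  ... | inj₂ S≈0   = S≈0

  multiples-root-sum : NoZeroDivisors → ∀ {ζ} e M s .{{_ : NonZero e}} .{{_ : NonZero M}} →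
    PrimitiveRoot (e ℕ.* M) ζ →
    ιℕ e * fold (e ℕ.* M) (λ k → charK (e ∣? k) * pow ζ (k ℕ.* s)) ≈ charK (e ℕ.* M ∣? e ℕ.* s) * ιℕ (e ℕ.* M)
  multiples-root-sum nzd {ζ} e M s prim = begin
    ιℕ e * fold N G                      ≈⟨ *-cong refl (fold-multiples e M G (λ k ¬e∣k → trans (*-cong (charK-no (e ∣? k) ¬e∣k) refl) (zeroˡ _))) ⟩
    ιℕ e * fold M (λ t → G (e ℕ.* t))    ≈⟨ *-cong refl (fold-cong M (λ t _ → G[et]≈ω^t t)) ⟩
    ιℕ e * fold M (pow ω)                ≈⟨ by-cases (N ∣? e ℕ.* s) ⟩
    charK (N ∣? e ℕ.* s) * ιℕ N          ∎
    where
    instance _ = ℕP.m*n≢0 e M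
    N = e ℕ.* M
    ω = pow ζ (e ℕ.* s)
    G : ℕ → Carrier
    G k = charK (e ∣? k) * pow ζ (k ℕ.* s)
    G[et]≈ω^t : ∀ t → G (e ℕ.* t) ≈ pow ω t
    G[et]≈ω^t t = begin
      charK (e ∣? e ℕ.* t) * pow ζ (e ℕ.* t ℕ.* s)   ≈⟨ *-cong (charK-yes (e ∣? e ℕ.* t) (m∣m*n t)) refl ⟩
      1# * pow ζ (e ℕ.* t ℕ.* s)                     ≈⟨ *-identityˡ _ ⟩
      pow ζ (e ℕ.* t ℕ.* s)                          ≡⟨ ≡.cong (pow ζ) (ets≡est e t s) ⟩
      pow ζ (e ℕ.* s ℕ.* t)                          ≈⟨ pow-* ζ (e ℕ.* s) t ⟩
      pow ω t                                        ∎
      where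
      ets≡est : ∀ e t s → e ℕ.* t ℕ.* s ≡ e ℕ.* s ℕ.* t
      ets≡est = solveℕ
    ω^M≈1 : pow ω M ≈ 1#
    ω^M≈1 = begin
      pow ω M                  ≈⟨ pow-* ζ (e ℕ.* s) M ⟨
      pow ζ (e ℕ.* s ℕ.* M)    ≡⟨ ≡.cong (pow ζ) (esM≡sN e s M) ⟩
      pow ζ (s ℕ.* N)          ≈⟨ pow≈1-multiple N s (proj₁ prim) ⟩
      1#                       ∎
      where
      esM≡sN : ∀ e s M → e ℕ.* s ℕ.* M ≡ s ℕ.* (e ℕ.* M)
      esM≡sN = solveℕ
    by-cases : (d : Dec (N ∣ e ℕ.* s)) → ιℕ e * fold M (pow ω) ≈ charK d * ιℕ N
    by-cases (yes N∣es) = begin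
      ιℕ e * fold M (pow ω)   ≈⟨ *-cong refl (fold-pow≈ιℕ M (primitive-∣⇒pow≈1 prim _ N∣es)) ⟩
      ιℕ e * ιℕ M             ≈⟨ ιℕ-* e M ⟨
      ιℕ N                    ≈⟨ *-identityˡ _ ⟨
      1# * ιℕ N               ∎
    by-cases (no N∤es) = begin
      ιℕ e * fold M (pow ω)   ≈⟨ *-cong refl (geometric-sum≈0 nzd M ω^M≈1 (N∤es ∘ primitive-pow≈1⇒∣ prim _)) ⟩
      ιℕ e * 0#               ≈⟨ zeroʳ _ ⟩
      0#                      ≈⟨ zeroˡ _ ⟨
      0# * ιℕ N               ∎

if-yes : ∀ {p b} {A : Set p} {B : Set b} (d : Dec A) {x y : B} → A → (if does d then x else y) ≡ x
if-yes d {x} {y} a = ≡.cong (if_then x else y) (dec-true d a)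

if-no : ∀ {p b} {A : Set p} {B : Set b} (d : Dec A) {x y : B} → ¬ A → (if does d then x else y) ≡ y
if-no d {x} {y} ¬a = ≡.cong (if_then x else y) (dec-false d ¬a)

prime≢1 : ∀ {p} → Prime p → p ≢ 1
prime≢1 pr ≡.refl = ¬prime[1] pr

SquareFree-∣ : ∀ {d n} → d ∣ n → SquareFree n → SquareFree d
SquareFree-∣ d∣n sf x x²∣d = sf x (∣-trans x²∣d d∣n)

nonZero-∣ : ∀ {m n} .{{_ : NonZero n}} → m ∣ n → NonZero m
nonZero-∣ {zero} {n} 0∣n = contradiction (0∣⇒≡0 0∣n) (ℕ.≢-nonZero⁻¹ n)
nonZero-∣ {suc m} _ = _

prime∤⇒coprime : ∀ {p e} → Prime p → ¬ p ∣ e → Coprime e p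
prime∤⇒coprime pr p∤e (i∣e , i∣p) with prime⇒irreducible pr i∣p
... | inj₁ i≡1   = i≡1
... | inj₂ ≡.refl = contradiction i∣e p∤e

SquareFree[m*n]⇒coprime : ∀ {m n} → SquareFree (m ℕ.* n) → Coprime m n
SquareFree[m*n]⇒coprime sf (i∣m , i∣n) = sf _ (*-pres-∣ i∣m i∣n)

SquareFree[p*e]⇒p∤e : ∀ {p e} → Prime p → SquareFree (p ℕ.* e) → ¬ p ∣ e
SquareFree[p*e]⇒p∤e {p} pr sf p∣e = prime≢1 pr (sf p (*-monoʳ-∣ p p∣e))

module PrimeDivisorProducts where

  PrimeDivisor : ℕ → ℕ → Set
  PrimeDivisor e q = Prime q × q ∣ e

  primeDivisor? : ∀ e q → Dec (PrimeDivisor e q)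
  primeDivisor? e q = prime? q ×-dec (q ∣? e)

  onPrimeDivisors : ℕ → (ℕ → ℤ) → ℕ → ℤ
  onPrimeDivisors e X q = if does (primeDivisor? e q) then X q else ℤ.1ℤ

  module _ {P : Pred ℕ 0ℓ} (P? : Decidable P) where

    foldr-filter≡∏ : ∀ (H : ℕ → ℤ) (g : ℕ → ℕ) n → foldr (λ p acc → H p ℤ.* acc) ℤ.1ℤ (filter P? (applyUpTo g n))
                              ≡ ∏ℤ.fold n (λ i → if does (P? (g i)) then H (g i) else ℤ.1ℤ)
    foldr-filter≡∏ H g zero = ≡.refl
    foldr-filter≡∏ H g (suc n) with does (P? (g 0))
    ... | true  = ≡.cong (H (g 0) ℤ.*_) (foldr-filter≡∏ H (g ∘ suc) n)
    ... | false = ≡.trans (foldr-filter≡∏ H (g ∘ suc) n) (≡.sym (ℤP.*-identityˡ _))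

  ^length≡foldr : ∀ {A : Set} x (xs : List A) → x ℤ.^ length xs ≡ foldr (λ _ acc → x ℤ.* acc) ℤ.1ℤ xs
  ^length≡foldr x []       = ≡.refl
  ^length≡foldr x (_ ∷ xs) = ≡.cong (x ℤ.*_) (^length≡foldr x xs)

  onPrimeDivisors-beyond : ∀ e X q .{{_ : NonZero e}} → e < q → onPrimeDivisors e X q ≡ ℤ.1ℤ
  onPrimeDivisors-beyond e X q e<q = if-no (primeDivisor? e q) (λ (_ , q∣e) → ℕP.<⇒≱ e<q (∣⇒≤ q∣e))

  foldr-primeDivisors≡∏ : ∀ e B X .{{_ : NonZero e}} → e < B →
    foldr (λ p acc → X p ℤ.* acc) ℤ.1ℤ (primeDivisors e) ≡ ∏ℤ.fold B (onPrimeDivisors e X)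
  foldr-primeDivisors≡∏ e B X e<B = ≡.trans (foldr-filter≡∏ {P = PrimeDivisor e} (primeDivisor? e) X id (suc e))
    (≡.sym (∏ℤ.fold-extend (suc e) B _ e<B (λ q e<q → onPrimeDivisors-beyond e X q e<q)))

  a≡∏ : ∀ e B .{{_ : NonZero e}} → e < B → a e ≡ ∏ℤ.fold B (onPrimeDivisors e (λ q → ℤ.1ℤ ℤ.- + q))
  a≡∏ e B = foldr-primeDivisors≡∏ e B (λ q → ℤ.1ℤ ℤ.- + q)

  μ≡∏ : ∀ e B .{{_ : NonZero e}} → SquareFree e → e < B → μ e ≡ ∏ℤ.fold B (onPrimeDivisors e (λ _ → ℤ.-1ℤ))
  μ≡∏ e B sf e<B with any? (λ p → (p ℕ.* p) ∣? e) (primeDivisors e)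
  ... | no _ = ≡.trans (^length≡foldr ℤ.-1ℤ (primeDivisors e)) (foldr-primeDivisors≡∏ e B (λ _ → ℤ.-1ℤ) e<B)
  ... | yes square with lookupAny (all-filter (primeDivisor? e) (upTo (suc e))) square
  ...   | (p-prime , _) , p²∣e = contradiction (sf _ p²∣e) (prime≢1 p-prime)

  onPrimeDivisors-*prime : ∀ p e X q → Prime p → ¬ p ∣ e →
    onPrimeDivisors (p ℕ.* e) X q ≡ (if does (q ℕ.≟ p) then X q else ℤ.1ℤ) ℤ.* onPrimeDivisors e X q
  onPrimeDivisors-*prime p e X q pr p∤e = by-cases (q ℕ.≟ p) (primeDivisor? e q)
    where
    by-cases : (q≟p : Dec (q ≡ p)) → Dec (PrimeDivisor e q) →
      onPrimeDivisors (p ℕ.* e) X q ≡ (if does q≟p then X q else ℤ.1ℤ) ℤ.* onPrimeDivisors e X q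
    by-cases (yes ≡.refl) _ =
      ≡.trans (if-yes (primeDivisor? (p ℕ.* e) p) (pr , m∣m*n e))
              (≡.sym (≡.trans (≡.cong (X p ℤ.*_) (if-no (primeDivisor? e p) (p∤e ∘ proj₂))) (ℤP.*-identityʳ (X p))))
    by-cases (no q≢p) (yes q∣e) =
      ≡.trans (if-yes (primeDivisor? (p ℕ.* e) q) (proj₁ q∣e , ∣-trans (proj₂ q∣e) (n∣m*n p)))
              (≡.sym (≡.trans (≡.cong (ℤ.1ℤ ℤ.*_) (if-yes (primeDivisor? e q) q∣e)) (ℤP.*-identityˡ (X q))))
    by-cases (no q≢p) (no q∤e) =
      ≡.trans (if-no (primeDivisor? (p ℕ.* e) q) q∤pe) (≡.sym (≡.cong (ℤ.1ℤ ℤ.*_) (if-no (primeDivisor? e q) q∤e)))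
      where
      q∤pe : ¬ PrimeDivisor (p ℕ.* e) q
      q∤pe (q-prime , q∣pe) with euclidsLemma p e q-prime q∣pe
      ... | inj₂ q∣e = q∤e (q-prime , q∣e)
      ... | inj₁ q∣p with prime⇒irreducible pr q∣p
      ...   | inj₁ q≡1 = prime≢1 q-prime q≡1
      ...   | inj₂ q≡p = q≢p q≡p

  ∏-onPrimeDivisors-*prime : ∀ p e X B → Prime p → ¬ p ∣ e → p < B →
    ∏ℤ.fold B (onPrimeDivisors (p ℕ.* e) X) ≡ X p ℤ.* ∏ℤ.fold B (onPrimeDivisors e X)
  ∏-onPrimeDivisors-*prime p e X B pr p∤e p<B = begin
    ∏ℤ.fold B (onPrimeDivisors (p ℕ.* e) X)
      ≡⟨ ∏ℤ.fold-cong B (λ q _ → onPrimeDivisors-*prime p e X q pr p∤e) ⟩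
    ∏ℤ.fold B (λ q → (if does (q ℕ.≟ p) then X q else ℤ.1ℤ) ℤ.* onPrimeDivisors e X q)
      ≡⟨ ∏ℤ.fold-∙ B _ _ ⟩
    ∏ℤ.fold B (λ q → if does (q ℕ.≟ p) then X q else ℤ.1ℤ) ℤ.* ∏ℤ.fold B (onPrimeDivisors e X)
      ≡⟨ ≡.cong (ℤ._* _) (∏ℤ.fold-single B _ p p<B (λ q _ q≢p → if-no (q ℕ.≟ p) q≢p)) ⟩
    (if does (p ℕ.≟ p) then X p else ℤ.1ℤ) ℤ.* ∏ℤ.fold B (onPrimeDivisors e X)
      ≡⟨ ≡.cong (ℤ._* _) (if-yes (p ℕ.≟ p) ≡.refl) ⟩
    X p ℤ.* ∏ℤ.fold B (onPrimeDivisors e X)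
      ∎
    where open ≡.≡-Reasoning

  -- Both products run over q < p·e + 1, a range that contains the prime divisors of e as well.
  a-*prime : ∀ p e .{{_ : NonZero e}} → Prime p → ¬ p ∣ e → a (p ℕ.* e) ≡ (ℤ.1ℤ ℤ.- + p) ℤ.* a e
  a-*prime p e pr p∤e = begin
    a (p ℕ.* e)                                    ≡⟨ a≡∏ (p ℕ.* e) B ℕP.≤-refl ⟩
    ∏ℤ.fold B (onPrimeDivisors (p ℕ.* e) X)        ≡⟨ ∏-onPrimeDivisors-*prime p e X B pr p∤e (s≤s (ℕP.m≤m*n p e)) ⟩
    X p ℤ.* ∏ℤ.fold B (onPrimeDivisors e X)        ≡⟨ ≡.cong (X p ℤ.*_) (a≡∏ e B (s≤s (ℕP.m≤n*m e p))) ⟨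
    X p ℤ.* a e                                    ∎
    where
    open ≡.≡-Reasoning
    instance _ = prime⇒nonZero pr
    instance _ = ℕP.m*n≢0 p e
    B = suc (p ℕ.* e)
    X : ℕ → ℤ
    X q = ℤ.1ℤ ℤ.- + q

  μ-*prime : ∀ p e .{{_ : NonZero e}} → Prime p → SquareFree (p ℕ.* e) → μ (p ℕ.* e) ≡ ℤ.-1ℤ ℤ.* μ e
  μ-*prime p e pr sf = begin
    μ (p ℕ.* e)                                    ≡⟨ μ≡∏ (p ℕ.* e) B sf ℕP.≤-refl ⟩
    ∏ℤ.fold B (onPrimeDivisors (p ℕ.* e) X)        ≡⟨ ∏-onPrimeDivisors-*prime p e X B pr (SquareFree[p*e]⇒p∤e pr sf) (s≤s (ℕP.m≤m*n p e)) ⟩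
    ℤ.-1ℤ ℤ.* ∏ℤ.fold B (onPrimeDivisors e X)      ≡⟨ ≡.cong (ℤ.-1ℤ ℤ.*_) (μ≡∏ e B (SquareFree-∣ (n∣m*n p) sf) (s≤s (ℕP.m≤n*m e p))) ⟨
    ℤ.-1ℤ ℤ.* μ e                                  ∎
    where
    open ≡.≡-Reasoning
    instance _ = prime⇒nonZero pr
    instance _ = ℕP.m*n≢0 p e
    B = suc (p ℕ.* e)
    X : ℕ → ℤ
    X _ = ℤ.-1ℤ

module DivisorSums where
  open PrimeDivisorProducts using (a-*prime; μ-*prime)
  open Indicator ℤP.+-*-commutativeRing using (charK-yes; charK-no)
  open ≡.≡-Reasoning

  ∑∣ : ℕ → ℕ → (ℕ → ℤ) → ℤ
  ∑∣ B g F = ∑ℤ.fold B (λ e → charℤ (e ∣? g) ℤ.* F e)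

  μ·id : ℕ → ℤ
  μ·id e = μ e ℤ.* + e

  ∑∣-bound : ∀ B g F .{{_ : NonZero g}} → g < B → ∑∣ B g F ≡ ∑∣ (suc g) g F
  ∑∣-bound B g F g<B = ∑ℤ.fold-extend (suc g) B _ g<B
    (λ e g<e → ≡.cong (ℤ._* F e) (charK-no (e ∣? g) (λ e∣g → ℕP.<⇒≱ g<e (∣⇒≤ e∣g))))

  -- For p ∤ g a divisor of p·g either divides g or is a multiple of p, never both.
  char∣p*g-split : ∀ p g e → Prime p → ¬ p ∣ g →
    charℤ (e ∣? p ℕ.* g) ≡ charℤ (e ∣? g) ℤ.+ charℤ (p ∣? e) ℤ.* charℤ (e ∣? p ℕ.* g)
  char∣p*g-split p g e pr p∤g = by-cases (e ∣? g) (p ∣? e) (e ∣? p ℕ.* g)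
    where
    by-cases : (e∣?g : Dec (e ∣ g)) (p∣?e : Dec (p ∣ e)) (e∣?pg : Dec (e ∣ p ℕ.* g)) →
      charℤ e∣?pg ≡ charℤ e∣?g ℤ.+ charℤ p∣?e ℤ.* charℤ e∣?pg
    by-cases (yes e∣g) (yes p∣e) _          = contradiction (∣-trans p∣e e∣g) p∤g
    by-cases (yes e∣g) (no _)    (yes _)    = ≡.refl
    by-cases (yes e∣g) (no _)    (no e∤pg)  = contradiction (∣-trans e∣g (n∣m*n p)) e∤pg
    by-cases (no e∤g)  (yes _)   (yes _)    = ≡.refl
    by-cases (no e∤g)  (no p∤e)  (yes e∣pg) = contradiction (coprime-divisor (prime∤⇒coprime pr p∤e) e∣pg) e∤g
    by-cases (no e∤g)  (no _)    (no _)     = ≡.refl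
    by-cases (no e∤g)  (yes _)   (no _)     = ≡.refl

  μ·id-*prime : ∀ p g t .{{_ : NonZero g}} → Prime p → SquareFree (p ℕ.* g) →
    charℤ (p ℕ.* t ∣? p ℕ.* g) ℤ.* μ·id (p ℕ.* t) ≡ ℤ.- + p ℤ.* (charℤ (t ∣? g) ℤ.* μ·id t)
  μ·id-*prime p g t pr sf with t ∣? g
  ... | yes t∣g = begin
    charℤ (p ℕ.* t ∣? p ℕ.* g) ℤ.* (μ (p ℕ.* t) ℤ.* + (p ℕ.* t))
      ≡⟨ ≡.cong₂ (λ c m → c ℤ.* (m ℤ.* + (p ℕ.* t))) (charK-yes (p ℕ.* t ∣? p ℕ.* g) (*-monoʳ-∣ p t∣g))
                 (μ-*prime p t {{nonZero-∣ t∣g}} pr (SquareFree-∣ (*-monoʳ-∣ p t∣g) sf)) ⟩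
    ℤ.1ℤ ℤ.* ((ℤ.-1ℤ ℤ.* μ t) ℤ.* + (p ℕ.* t))
      ≡⟨ ≡.cong (λ pt → ℤ.1ℤ ℤ.* ((ℤ.-1ℤ ℤ.* μ t) ℤ.* pt)) (ℤP.pos-* p t) ⟩
    ℤ.1ℤ ℤ.* ((ℤ.-1ℤ ℤ.* μ t) ℤ.* (+ p ℤ.* + t))
      ≡⟨ regroup (μ t) (+ p) (+ t) ⟩
    ℤ.- + p ℤ.* (ℤ.1ℤ ℤ.* (μ t ℤ.* + t))
      ∎
    where
    regroup : ∀ m x y → ℤ.1ℤ ℤ.* ((ℤ.-1ℤ ℤ.* m) ℤ.* (x ℤ.* y)) ≡ ℤ.- x ℤ.* (ℤ.1ℤ ℤ.* (m ℤ.* y))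
    regroup = solveℤ
  ... | no t∤g = begin
    charℤ (p ℕ.* t ∣? p ℕ.* g) ℤ.* μ·id (p ℕ.* t)
      ≡⟨ ≡.cong (ℤ._* μ·id (p ℕ.* t)) (charK-no (p ℕ.* t ∣? p ℕ.* g) (t∤g ∘ *-cancelˡ-∣ p {{prime⇒nonZero pr}})) ⟩
    ℤ.0ℤ
      ≡⟨ ℤP.*-zeroʳ (ℤ.- + p) ⟨
    ℤ.- + p ℤ.* ℤ.0ℤ
      ∎

  ∑[p∣e]∣μ·id : ∀ p g .{{_ : NonZero g}} → Prime p → SquareFree (p ℕ.* g) →
    ∑ℤ.fold (p ℕ.* suc g) (λ e → charℤ (p ∣? e) ℤ.* (charℤ (e ∣? p ℕ.* g) ℤ.* μ·id e)) ≡ ℤ.- + p ℤ.* ∑∣ (suc g) g μ·id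
  ∑[p∣e]∣μ·id p g pr sf = begin
    ∑ℤ.fold (p ℕ.* suc g) F
      ≡⟨ ∑ℤ.fold-multiples p (suc g) F (λ e p∤e → ≡.cong (ℤ._* (charℤ (e ∣? p ℕ.* g) ℤ.* μ·id e)) (charK-no (p ∣? e) p∤e)) ⟩
    ∑ℤ.fold (suc g) (λ t → F (p ℕ.* t))
      ≡⟨ ∑ℤ.fold-cong (suc g) (λ t _ → ≡.trans (≡.cong (ℤ._* (charℤ (p ℕ.* t ∣? p ℕ.* g) ℤ.* μ·id (p ℕ.* t)))
                                                       (charK-yes (p ∣? p ℕ.* t) (m∣m*n t)))
                                                (≡.trans (ℤP.*-identityˡ _) (μ·id-*prime p g t pr sf))) ⟩
    ∑ℤ.fold (suc g) (λ t → ℤ.- + p ℤ.* (charℤ (t ∣? g) ℤ.* μ·id t))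
      ≡⟨ ∑ℤ.*-distribˡ-fold (suc g) (ℤ.- + p) (λ t → charℤ (t ∣? g) ℤ.* μ·id t) ⟨
    ℤ.- + p ℤ.* ∑∣ (suc g) g μ·id
      ∎
    where
    instance _ = prime⇒nonZero pr
    F : ℕ → ℤ
    F e = charℤ (p ∣? e) ℤ.* (charℤ (e ∣? p ℕ.* g) ℤ.* μ·id e)

  a≡∑∣μ·id-*prime : ∀ p g .{{_ : NonZero g}} → Prime p → SquareFree (p ℕ.* g) →
    a g ≡ ∑∣ (suc g) g μ·id → a (p ℕ.* g) ≡ ∑∣ (suc (p ℕ.* g)) (p ℕ.* g) μ·id
  a≡∑∣μ·id-*prime p g pr sf a≡∑ = ≡.sym (begin
    ∑∣ (suc G) G μ·id
      ≡⟨ ∑∣-bound B G μ·id G<B ⟨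
    ∑∣ B G μ·id
      ≡⟨ ∑ℤ.fold-cong B (λ e _ → split e) ⟩
    ∑ℤ.fold B (λ e → charℤ (e ∣? g) ℤ.* μ·id e ℤ.+ charℤ (p ∣? e) ℤ.* (charℤ (e ∣? G) ℤ.* μ·id e))
      ≡⟨ ∑ℤ.fold-∙ B _ _ ⟩
    ∑∣ B g μ·id ℤ.+ ∑ℤ.fold B (λ e → charℤ (p ∣? e) ℤ.* (charℤ (e ∣? G) ℤ.* μ·id e))
      ≡⟨ ≡.cong₂ ℤ._+_ (∑∣-bound B g μ·id g<B) (∑[p∣e]∣μ·id p g pr sf) ⟩
    ∑∣ (suc g) g μ·id ℤ.+ ℤ.- + p ℤ.* ∑∣ (suc g) g μ·id
      ≡⟨ ≡.cong (λ x → x ℤ.+ ℤ.- + p ℤ.* x) a≡∑ ⟨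
    a g ℤ.+ ℤ.- + p ℤ.* a g
      ≡⟨ factor (a g) (+ p) ⟩
    (ℤ.1ℤ ℤ.- + p) ℤ.* a g
      ≡⟨ a-*prime p g pr (SquareFree[p*e]⇒p∤e pr sf) ⟨
    a G
      ∎)
    where
    instance _ = prime⇒nonZero pr
    instance _ = ℕP.m*n≢0 p g
    G = p ℕ.* g
    B = p ℕ.* suc g
    G<B : G < B
    G<B = ≡.subst (G <_) (≡.sym (ℕP.*-suc p g)) (ℕP.+-monoˡ-< G (ℕ.>-nonZero⁻¹ p))
    g<B : g < B
    g<B = ℕP.<-≤-trans (ℕP.n<1+n g) (ℕP.m≤n*m (suc g) p)
    split : ∀ e → charℤ (e ∣? G) ℤ.* μ·id e ≡ charℤ (e ∣? g) ℤ.* μ·id e ℤ.+ charℤ (p ∣? e) ℤ.* (charℤ (e ∣? G) ℤ.* μ·id e)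
    split e = ≡.trans (≡.cong (ℤ._* μ·id e) (char∣p*g-split p g e pr (SquareFree[p*e]⇒p∤e pr sf)))
                      (distrib-assoc (charℤ (e ∣? g)) (charℤ (p ∣? e)) (charℤ (e ∣? G)) (μ·id e))
      where
      distrib-assoc : ∀ x y z w → (x ℤ.+ y ℤ.* z) ℤ.* w ≡ x ℤ.* w ℤ.+ y ℤ.* (z ℤ.* w)
      distrib-assoc = solveℤ
    factor : ∀ x y → x ℤ.+ ℤ.- y ℤ.* x ≡ (ℤ.1ℤ ℤ.- y) ℤ.* x
    factor = solveℤ

  a≡∑∣μ·id : ∀ g .{{_ : NonZero g}} → SquareFree g → a g ≡ ∑∣ (suc g) g μ·id
  a≡∑∣μ·id g sf = ≡.subst (λ n → SquareFree n → a n ≡ ∑∣ (suc n) n μ·id) (≡.sym isFactorisation)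
                          (overPrimes factors factorsPrime) sf
    where
    open PrimeFactorisation (factorise g)
    overPrimes : ∀ ps → All Prime ps → SquareFree (product ps) → a (product ps) ≡ ∑∣ (suc (product ps)) (product ps) μ·id
    overPrimes []       _            _  = ≡.refl
    overPrimes (p ∷ ps) (pr ∷ prime) sf =
      a≡∑∣μ·id-*prime p (product ps) {{productOfPrimes≢0 prime}} pr sf
        (overPrimes ps prime (SquareFree-∣ (n∣m*n p) sf))

∣gcd⇔ : ∀ {d m n} → d ∣ gcd m n ⇔ (d ∣ m × d ∣ n)
∣gcd⇔ {d} {m} {n} = mk⇔ (λ d∣g → ∣-trans d∣g (gcd[m,n]∣m m n) , ∣-trans d∣g (gcd[m,n]∣n m n))
                         (λ (d∣m , d∣n) → gcd-greatest d∣m d∣n)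

fClosed : ℕ → ℕ → ℕ → ℤ
fClosed N J s = ∑ℤ.fold (suc N) (λ e → ((charℤ (e ∣? J) ℤ.* charℤ (e ∣? N)) ℤ.* μ e) ℤ.* charℤ (N ∣? e ℕ.* s))

module ExponentialSum {c ℓ} (K : CommutativeRing c ℓ) where
  open CommutativeRing K
  open Over K
  open RangeSum K
  open Indicator K
  open IntegerEmbedding K using (ι-*; ι-fold; ι-charℤ)
  open RootsOfUnity K using (multiples-root-sum)
  open DivisorSums using (∑∣; ∑∣-bound; μ·id; a≡∑∣μ·id)
  open import Algebra.Solver.CommutativeMonoid *-commutativeMonoid using (solve; _⊕_; _⊜_)
  open import Relation.Binary.Reasoning.Setoid setoid

  module _ (N : ℕ) .{{_ : NonZero N}} (ζ : Carrier) (J s : ℕ) where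

    coeff : ℕ → Carrier
    coeff e = (charK (e ∣? J) * charK (e ∣? N)) * ι (μ e)

    rootTerm : ℕ → ℕ → Carrier
    rootTerm e k = charK (e ∣? k) * pow ζ (k ℕ.* s)

    ι[fClosed] : ι (fClosed N J s) ≈ fold (suc N) (λ e → coeff e * charK (N ∣? e ℕ.* s))
    ι[fClosed] = trans (ι-fold (suc N) (λ e → ((charℤ (e ∣? J) ℤ.* charℤ (e ∣? N)) ℤ.* μ e) ℤ.* charℤ (N ∣? e ℕ.* s)))
                       (fold-cong (suc N) (λ e _ → ι-term e))
      where
      ι-term : ∀ e → ι (((charℤ (e ∣? J) ℤ.* charℤ (e ∣? N)) ℤ.* μ e) ℤ.* charℤ (N ∣? e ℕ.* s))
                     ≈ coeff e * charK (N ∣? e ℕ.* s)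
      ι-term e = trans (ι-* (cJ ℤ.* cN ℤ.* μ e) cS) (*-cong (trans (ι-* (cJ ℤ.* cN) (μ e)) (*-cong (trans (ι-* cJ cN)
                   (*-cong (ι-charℤ (e ∣? J)) (ι-charℤ (e ∣? N)))) refl)) (ι-charℤ (N ∣? e ℕ.* s)))
        where
        cJ = charℤ (e ∣? J)
        cN = charℤ (e ∣? N)
        cS = charℤ (N ∣? e ℕ.* s)

    a[gcd]ζ^ks≈ : SquareFree N → ∀ k →
      ι (a (gcd J (gcd k N))) * pow ζ (k ℕ.* s) ≈ fold (suc N) (λ e → coeff e * (ιℕ e * rootTerm e k))
    a[gcd]ζ^ks≈ sf k = begin
      ι (a g) * pow ζ (k ℕ.* s)
        ≡⟨ ≡.cong (λ x → ι x * pow ζ (k ℕ.* s)) a[g]≡∑∣μ·id ⟩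
      ι (∑∣ (suc N) g μ·id) * pow ζ (k ℕ.* s)
        ≈⟨ *-cong (ι-fold (suc N) (λ e → charℤ (e ∣? g) ℤ.* μ·id e)) refl ⟩
      fold (suc N) (λ e → ι (charℤ (e ∣? g) ℤ.* μ·id e)) * pow ζ (k ℕ.* s)
        ≈⟨ *-distribʳ-fold (suc N) (pow ζ (k ℕ.* s)) (λ e → ι (charℤ (e ∣? g) ℤ.* μ·id e)) ⟩
      fold (suc N) (λ e → ι (charℤ (e ∣? g) ℤ.* μ·id e) * pow ζ (k ℕ.* s))
        ≈⟨ fold-cong (suc N) (λ e _ → term e) ⟩
      fold (suc N) (λ e → coeff e * (ιℕ e * rootTerm e k))
        ∎
      where
      g = gcd J (gcd k N)
      g∣N : g ∣ N
      g∣N = ∣-trans (gcd[m,n]∣n J (gcd k N)) (gcd[m,n]∣n k N)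
      instance _ = nonZero-∣ g∣N
      a[g]≡∑∣μ·id : a g ≡ ∑∣ (suc N) g μ·id
      a[g]≡∑∣μ·id = ≡.trans (a≡∑∣μ·id g (SquareFree-∣ g∣N sf)) (≡.sym (∑∣-bound (suc N) g μ·id (s≤s (∣⇒≤ g∣N))))
      term : ∀ e → ι (charℤ (e ∣? g) ℤ.* μ·id e) * pow ζ (k ℕ.* s) ≈ coeff e * (ιℕ e * rootTerm e k)
      term e = begin
        ι (charℤ (e ∣? g) ℤ.* (μ e ℤ.* + e)) * pow ζ (k ℕ.* s)
          ≈⟨ *-cong (trans (ι-* (charℤ (e ∣? g)) (μ·id e)) (*-cong (ι-charℤ (e ∣? g)) (ι-* (μ e) (+ e)))) refl ⟩
        (charK (e ∣? g) * (ι (μ e) * ιℕ e)) * pow ζ (k ℕ.* s)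
          ≈⟨ *-cong (*-cong (trans (charK-× (e ∣? g) (e ∣? J) (e ∣? gcd k N) ∣gcd⇔)
                                   (*-cong refl (charK-× (e ∣? gcd k N) (e ∣? k) (e ∣? N) ∣gcd⇔))) refl) refl ⟩
        ((charK (e ∣? J) * (charK (e ∣? k) * charK (e ∣? N))) * (ι (μ e) * ιℕ e)) * pow ζ (k ℕ.* s)
          ≈⟨ solve 6 (λ cJ ck cN m i w → ((cJ ⊕ (ck ⊕ cN)) ⊕ (m ⊕ i)) ⊕ w ⊜ ((cJ ⊕ cN) ⊕ m) ⊕ (i ⊕ (ck ⊕ w))) refl _ _ _ _ _ _ ⟩
        coeff e * (ιℕ e * rootTerm e k)
          ∎

    ∑coeff*rootTerm : NoZeroDivisors → PrimitiveRoot N ζ → ∀ e →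
      fold N (λ k → coeff e * (ιℕ e * rootTerm e k)) ≈ coeff e * (charK (N ∣? e ℕ.* s) * ιℕ N)
    ∑coeff*rootTerm nzd prim e = by-cases (e ∣? N)
      where
      by-cases : Dec (e ∣ N) → fold N (λ k → coeff e * (ιℕ e * rootTerm e k)) ≈ coeff e * (charK (N ∣? e ℕ.* s) * ιℕ N)
      by-cases (no e∤N) = begin
        fold N (λ k → coeff e * (ιℕ e * rootTerm e k))    ≈⟨ fold-ε N (λ k → coeff e * (ιℕ e * rootTerm e k)) (λ k _ → coeff*≈0) ⟩
        0#                                                 ≈⟨ coeff*≈0 ⟨
        coeff e * (charK (N ∣? e ℕ.* s) * ιℕ N)            ∎
        where
        coeff*≈0 : ∀ {x} → coeff e * x ≈ 0#
        coeff*≈0 = trans (*-cong (trans (*-cong (trans (*-cong refl (charK-no (e ∣? N) e∤N)) (zeroʳ _)) refl) (zeroˡ _)) refl) (zeroˡ _)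
      by-cases (yes e∣N@(divides M N≡Me)) = begin
        fold N (λ k → coeff e * (ιℕ e * rootTerm e k))    ≈⟨ *-distribˡ-fold N (coeff e) (λ k → ιℕ e * rootTerm e k) ⟨
        coeff e * fold N (λ k → ιℕ e * rootTerm e k)      ≈⟨ *-cong refl (*-distribˡ-fold N (ιℕ e) (rootTerm e)) ⟨
        coeff e * (ιℕ e * fold N (rootTerm e))            ≈⟨ *-cong refl (≡.subst P (≡.sym N≡eM) multiples-root-sum′ prim) ⟩
        coeff e * (charK (N ∣? e ℕ.* s) * ιℕ N)           ∎
        where
        N≡eM : N ≡ e ℕ.* M
        N≡eM = ≡.trans N≡Me (ℕP.*-comm M e)
        P : ℕ → Set _
        P n = PrimitiveRoot n ζ → ιℕ e * fold n (rootTerm e) ≈ charK (n ∣? e ℕ.* s) * ιℕ n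
        multiples-root-sum′ : P (e ℕ.* M)
        multiples-root-sum′ = multiples-root-sum nzd e M s {{nonZero-∣ e∣N}} {{nonZero-∣ (divides e N≡eM)}}

  f≈ι[fClosed] : ∀ N .{{_ : NonZero N}} ζ Ninv j s → SquareFree N → NoZeroDivisors →
    PrimitiveRoot N ζ → IsInverseOf N Ninv → f N ζ Ninv j s ≈ ι (fClosed N ℤ.∣ j ∣ (s %ℕ N))
  f≈ι[fClosed] N ζ Ninv j s sf nzd prim N·Ninv≈1 = begin
    Ninv * sumK (map summand (upTo N))
      ≡⟨ ≡.cong (Ninv *_) (fold-upTo N summand) ⟩
    Ninv * fold N summand
      ≈⟨ *-cong refl (fold-cong N (λ k _ → a[gcd]ζ^ks≈ N ζ J s′ sf k)) ⟩
    Ninv * fold N (λ k → fold (suc N) (λ e → coeff′ e * (ιℕ e * rootTerm′ e k)))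
      ≈⟨ *-cong refl (fold-swap N (suc N) (λ k e → coeff′ e * (ιℕ e * rootTerm′ e k))) ⟩
    Ninv * fold (suc N) (λ e → fold N (λ k → coeff′ e * (ιℕ e * rootTerm′ e k)))
      ≈⟨ *-cong refl (fold-cong (suc N) (λ e _ → ∑coeff*rootTerm N ζ J s′ nzd prim e)) ⟩
    Ninv * fold (suc N) (λ e → coeff′ e * (charK (N ∣? e ℕ.* s′) * ιℕ N))
      ≈⟨ *-distribˡ-fold (suc N) Ninv (λ e → coeff′ e * (charK (N ∣? e ℕ.* s′) * ιℕ N)) ⟩
    fold (suc N) (λ e → Ninv * (coeff′ e * (charK (N ∣? e ℕ.* s′) * ιℕ N)))
      ≈⟨ fold-cong (suc N) (λ e _ → cancel-N (coeff′ e) (charK (N ∣? e ℕ.* s′))) ⟩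
    fold (suc N) (λ e → coeff′ e * charK (N ∣? e ℕ.* s′))
      ≈⟨ ι[fClosed] N ζ J s′ ⟨
    ι (fClosed N J s′)
      ∎
    where
    J  = ℤ.∣ j ∣
    s′ = s %ℕ N
    coeff′ : ℕ → Carrier
    coeff′ = coeff N ζ J s′
    rootTerm′ : ℕ → ℕ → Carrier
    rootTerm′ = rootTerm N ζ J s′
    summand : ℕ → Carrier
    summand k = ι (a (gcd J (gcd k N))) * pow ζ (k ℕ.* s′)
    cancel-N : ∀ x y → Ninv * (x * (y * ιℕ N)) ≈ x * y
    cancel-N x y = begin
      Ninv * (x * (y * ιℕ N))    ≈⟨ solve 4 (λ n x y i → n ⊕ (x ⊕ (y ⊕ i)) ⊜ (x ⊕ y) ⊕ (i ⊕ n)) refl Ninv x y (ιℕ N) ⟩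
      (x * y) * (ιℕ N * Ninv)    ≈⟨ *-cong refl N·Ninv≈1 ⟩
      (x * y) * 1#               ≈⟨ *-identityʳ _ ⟩
      x * y                      ∎

module FactorisationSums where
  open DivisorSums using (∑∣)
  open Indicator ℤP.+-*-commutativeRing using (charK-yes; charK-no)
  open ≡.≡-Reasoning

  sumℤ-++ : ∀ xs ys → sumℤ (xs ++ ys) ≡ sumℤ xs ℤ.+ sumℤ ys
  sumℤ-++ []       ys = ≡.sym (ℤP.+-identityˡ _)
  sumℤ-++ (x ∷ xs) ys = ≡.trans (≡.cong (ℤ._+_ x) (sumℤ-++ xs ys)) (≡.sym (ℤP.+-assoc x _ _))

  sumℤ-filter : ∀ {A : Set} {P : Pred A 0ℓ} (P? : Decidable P) (H : A → ℤ) xs →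
    sumℤ (map H (filter P? xs)) ≡ sumℤ (map (λ z → charℤ (P? z) ℤ.* H z) xs)
  sumℤ-filter P? H []       = ≡.refl
  sumℤ-filter P? H (x ∷ xs) with does (P? x)
  ... | true  = ≡.cong₂ ℤ._+_ (≡.sym (ℤP.*-identityˡ (H x))) (sumℤ-filter P? H xs)
  ... | false = ≡.trans (sumℤ-filter P? H xs) (≡.sym (ℤP.+-identityˡ _))

  sumℤ-cartesianProduct : ∀ {A B : Set} (H : A × B → ℤ) xs ys →
    sumℤ (map H (cartesianProduct xs ys)) ≡ sumℤ (map (λ x → sumℤ (map (λ y → H (x , y)) ys)) xs)
  sumℤ-cartesianProduct H []       ys = ≡.refl
  sumℤ-cartesianProduct H (x ∷ xs) ys = begin
    sumℤ (map H (map (x ,_) ys ++ cartesianProduct xs ys))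
      ≡⟨ ≡.cong sumℤ (map-++ H (map (x ,_) ys) _) ⟩
    sumℤ (map H (map (x ,_) ys) ++ map H (cartesianProduct xs ys))
      ≡⟨ sumℤ-++ (map H (map (x ,_) ys)) _ ⟩
    sumℤ (map H (map (x ,_) ys)) ℤ.+ sumℤ (map H (cartesianProduct xs ys))
      ≡⟨ ≡.cong₂ ℤ._+_ (≡.cong sumℤ (≡.sym (map-∘ ys))) (sumℤ-cartesianProduct H xs ys) ⟩
    sumℤ (map (λ y → H (x , y)) ys) ℤ.+ sumℤ (map (λ x → sumℤ (map (λ y → H (x , y)) ys)) xs)
      ∎

  ∑char[x*y≡M]≡char[x∣M] : ∀ M x .{{_ : NonZero M}} → ∑ℤ.fold (suc M) (λ y → charℤ (x ℕ.* y ℕ.≟ M)) ≡ charℤ (x ∣? M)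
  ∑char[x*y≡M]≡char[x∣M] M x with x ∣? M
  ... | yes x∣M@(divides y M≡yx) = ≡.trans
        (∑ℤ.fold-single (suc M) _ y (s≤s (∣⇒≤ (divides x (≡.trans M≡yx (ℕP.*-comm y x)))))
          (λ v _ v≢y → charK-no (x ℕ.* v ℕ.≟ M) (λ xv≡M → v≢y (ℕP.*-cancelˡ-≡ v y x {{x≢0}} (≡.trans xv≡M xy≡M⁻¹)))))
        (charK-yes (x ℕ.* y ℕ.≟ M) (≡.sym xy≡M⁻¹))
    where
    xy≡M⁻¹ : M ≡ x ℕ.* y
    xy≡M⁻¹ = ≡.trans M≡yx (ℕP.*-comm y x)
    x≢0 : NonZero x
    x≢0 = nonZero-∣ x∣M
  ... | no x∤M = ∑ℤ.fold-ε (suc M) _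
        (λ y _ → charK-no (x ℕ.* y ℕ.≟ M) (λ xy≡M → x∤M (divides y (≡.trans (≡.sym xy≡M) (ℕP.*-comm x y)))))

  sumℤ-factorizations-cong : ∀ M {H H′ : ℕ × ℕ → ℤ} → (∀ x y → x ℕ.* y ≡ M → H (x , y) ≡ H′ (x , y)) →
    sumℤ (map H (factorizations M)) ≡ sumℤ (map H′ (factorizations M))
  sumℤ-factorizations-cong M {H} {H′} H≡H′ = ≡.cong sumℤ (map-cong-local {f = H} {g = H′}
    (All.map (λ {(x , y)} → H≡H′ x y) (all-filter (λ xy → proj₁ xy ℕ.* proj₂ xy ℕ.≟ M) (cartesianProduct (upTo (suc M)) (upTo (suc M))))))

  sumℤ-factorizations-proj₁ : ∀ M .{{_ : NonZero M}} (F : ℕ → ℤ) →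
    sumℤ (map (F ∘ proj₁) (factorizations M)) ≡ ∑∣ (suc M) M F
  sumℤ-factorizations-proj₁ M F = begin
    sumℤ (map (F ∘ proj₁) (factorizations M))
      ≡⟨ sumℤ-filter (λ xy → proj₁ xy ℕ.* proj₂ xy ℕ.≟ M) (F ∘ proj₁) (cartesianProduct (upTo (suc M)) (upTo (suc M))) ⟩
    sumℤ (map (λ xy → charℤ (proj₁ xy ℕ.* proj₂ xy ℕ.≟ M) ℤ.* F (proj₁ xy)) (cartesianProduct (upTo (suc M)) (upTo (suc M))))
      ≡⟨ sumℤ-cartesianProduct (λ xy → charℤ (proj₁ xy ℕ.* proj₂ xy ℕ.≟ M) ℤ.* F (proj₁ xy)) (upTo (suc M)) (upTo (suc M)) ⟩
    sumℤ (map (λ x → sumℤ (map (λ y → charℤ (x ℕ.* y ℕ.≟ M) ℤ.* F x) (upTo (suc M)))) (upTo (suc M)))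
      ≡⟨ ∑ℤ.fold-upTo (suc M) (λ x → sumℤ (map (λ y → charℤ (x ℕ.* y ℕ.≟ M) ℤ.* F x) (upTo (suc M)))) ⟩
    ∑ℤ.fold (suc M) (λ x → sumℤ (map (λ y → charℤ (x ℕ.* y ℕ.≟ M) ℤ.* F x) (upTo (suc M))))
      ≡⟨ ∑ℤ.fold-cong (suc M) (λ x _ → ∑ℤ.fold-upTo (suc M) (λ y → charℤ (x ℕ.* y ℕ.≟ M) ℤ.* F x)) ⟩
    ∑ℤ.fold (suc M) (λ x → ∑ℤ.fold (suc M) (λ y → charℤ (x ℕ.* y ℕ.≟ M) ℤ.* F x))
      ≡⟨ ∑ℤ.fold-cong (suc M) (λ x _ → ∑ℤ.*-distribʳ-fold (suc M) (F x) (λ y → charℤ (x ℕ.* y ℕ.≟ M))) ⟨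
    ∑ℤ.fold (suc M) (λ x → ∑ℤ.fold (suc M) (λ y → charℤ (x ℕ.* y ℕ.≟ M)) ℤ.* F x)
      ≡⟨ ∑ℤ.fold-cong (suc M) (λ x _ → ≡.cong (ℤ._* F x) (∑char[x*y≡M]≡char[x∣M] M x)) ⟩
    ∑∣ (suc M) M F
      ∎

module CoprimeDivisorSums (R Q : ℕ) .{{_ : NonZero R}} .{{_ : NonZero Q}} (R⊥Q : Coprime R Q) where
  open DivisorSums using (∑∣)
  open Indicator ℤP.+-*-commutativeRing using (charK-yes; charK-no; charK-*-cong)
  open ≡.≡-Reasoning

  -- A division-free form of x ∣ d ∧ d / x ∣ Q.
  RPart : ℕ → ℕ → Set
  RPart d x = x ∣ d × d ∣ Q ℕ.* x

  rPart? : ∀ d x → Dec (RPart d x)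
  rPart? d x = (x ∣? d) ×-dec (d ∣? Q ℕ.* x)

  ∑char[d≡x*u]≡char[RPart] : ∀ d x .{{_ : NonZero x}} →
    ∑ℤ.fold (suc Q) (λ u → charℤ (u ∣? Q) ℤ.* charℤ (d ℕ.≟ x ℕ.* u)) ≡ charℤ (rPart? d x)
  ∑char[d≡x*u]≡char[RPart] d x = by-cases (x ∣? d)
    where
    S = ∑ℤ.fold (suc Q) (λ u → charℤ (u ∣? Q) ℤ.* charℤ (d ℕ.≟ x ℕ.* u))
    by-cases : Dec (x ∣ d) → S ≡ charℤ (rPart? d x)
    by-cases (no x∤d) = ≡.trans
      (∑ℤ.fold-ε (suc Q) _ (λ u _ → ≡.trans (≡.cong (charℤ (u ∣? Q) ℤ.*_)
          (charK-no (d ℕ.≟ x ℕ.* u) (λ d≡xu → x∤d (divides u (≡.trans d≡xu (ℕP.*-comm x u)))))) (ℤP.*-zeroʳ (charℤ (u ∣? Q)))))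
      (≡.sym (charK-no (rPart? d x) (x∤d ∘ proj₁)))
    by-cases (yes x∣d@(divides w d≡wx)) = by-cases′ (w ∣? Q)
      where
      d≡xw : d ≡ x ℕ.* w
      d≡xw = ≡.trans d≡wx (ℕP.*-comm w x)
      u≡w : ∀ {u} → d ≡ x ℕ.* u → u ≡ w
      u≡w d≡xu = ℕP.*-cancelˡ-≡ _ w x (≡.trans (≡.sym d≡xu) d≡xw)
      by-cases′ : Dec (w ∣ Q) → S ≡ charℤ (rPart? d x)
      by-cases′ (yes w∣Q) = ≡.trans
        (∑ℤ.fold-single (suc Q) _ w (s≤s (∣⇒≤ w∣Q))
          (λ u _ u≢w → ≡.trans (≡.cong (charℤ (u ∣? Q) ℤ.*_) (charK-no (d ℕ.≟ x ℕ.* u) (u≢w ∘ u≡w))) (ℤP.*-zeroʳ (charℤ (u ∣? Q)))))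
        (≡.trans (≡.cong₂ ℤ._*_ (charK-yes (w ∣? Q) w∣Q) (charK-yes (d ℕ.≟ x ℕ.* w) d≡xw))
                 (≡.sym (charK-yes (rPart? d x) (x∣d , ≡.subst (_∣ Q ℕ.* x) (≡.sym d≡wx) (*-monoˡ-∣ x w∣Q)))))
      by-cases′ (no w∤Q) = ≡.trans
        (∑ℤ.fold-ε (suc Q) _ (λ u _ → term≡0 (u ∣? Q) (d ℕ.≟ x ℕ.* u)))
        (≡.sym (charK-no (rPart? d x) (λ (_ , d∣Qx) → w∤Q (*-cancelʳ-∣ x (≡.subst (_∣ Q ℕ.* x) d≡wx d∣Qx)))))
        where
        term≡0 : ∀ {u} (u∣?Q : Dec (u ∣ Q)) (d≟xu : Dec (d ≡ x ℕ.* u)) → charℤ u∣?Q ℤ.* charℤ d≟xu ≡ ℤ.0ℤ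
        term≡0 (no _)    _          = ≡.refl
        term≡0 (yes _)   (no _)     = ≡.refl
        term≡0 (yes u∣Q) (yes d≡xu) = contradiction (≡.subst (_∣ Q) (u≡w d≡xu) u∣Q) w∤Q

  RPart⇒≡gcd : ∀ {d x} → x ∣ R → RPart d x → x ≡ gcd d R
  RPart⇒≡gcd {d} {x} x∣R (x∣d , d∣Qx) = ∣-antisym (gcd-greatest x∣d x∣R) (coprime-divisor gcd⊥Q (∣-trans (gcd[m,n]∣m d R) d∣Qx))
    where
    gcd⊥Q : Coprime (gcd d R) Q
    gcd⊥Q (i∣gcd , i∣Q) = R⊥Q (∣-trans i∣gcd (gcd[m,n]∣n d R) , i∣Q)

  RPart[gcd] : ∀ {d} → d ∣ R ℕ.* Q → RPart d (gcd d R)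
  RPart[gcd] {d} d∣RQ = gcd[m,n]∣m d R ,
    ≡.subst (d ∣_) (≡.sym (c*gcd[m,n]≡gcd[cm,cn] Q d R)) (gcd-greatest (n∣m*n Q) (≡.subst (d ∣_) (ℕP.*-comm R Q) d∣RQ))

  ∑∣char[RPart]≡char[d∣RQ] : ∀ d → ∑∣ (suc R) R (λ x → charℤ (rPart? d x)) ≡ charℤ (d ∣? R ℕ.* Q)
  ∑∣char[RPart]≡char[d∣RQ] d with d ∣? R ℕ.* Q
  ... | yes d∣RQ = ≡.trans
        (∑ℤ.fold-single (suc R) _ (gcd d R) (s≤s (∣⇒≤ (gcd[m,n]∣n d R))) (λ x _ x≢gcd → term≡0 x x≢gcd (x ∣? R)))
        (≡.cong₂ ℤ._*_ (charK-yes (gcd d R ∣? R) (gcd[m,n]∣n d R)) (charK-yes (rPart? d (gcd d R)) (RPart[gcd] d∣RQ)))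
    where
    term≡0 : ∀ x → x ≢ gcd d R → (x∣?R : Dec (x ∣ R)) → charℤ x∣?R ℤ.* charℤ (rPart? d x) ≡ ℤ.0ℤ
    term≡0 x x≢gcd (no _)    = ≡.refl
    term≡0 x x≢gcd (yes x∣R) = ≡.cong (ℤ.1ℤ ℤ.*_) (charK-no (rPart? d x) (x≢gcd ∘ RPart⇒≡gcd x∣R))
  ... | no d∤RQ = ∑ℤ.fold-ε (suc R) _ (λ x _ → term≡0 x (x ∣? R))
    where
    term≡0 : ∀ x (x∣?R : Dec (x ∣ R)) → charℤ x∣?R ℤ.* charℤ (rPart? d x) ≡ ℤ.0ℤ
    term≡0 x (no _)    = ≡.refl
    term≡0 x (yes x∣R) = ≡.cong (ℤ.1ℤ ℤ.*_) (charK-no (rPart? d x)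
      (λ (x∣d , d∣Qx) → d∤RQ (∣-trans d∣Qx (≡.subst (Q ℕ.* x ∣_) (ℕP.*-comm Q R) (*-monoʳ-∣ Q x∣R)))))

  ∑∣-* : ∀ (G : ℕ → ℤ) → ∑∣ (suc R) R (λ x → ∑∣ (suc Q) Q (λ u → G (x ℕ.* u))) ≡ ∑∣ (suc (R ℕ.* Q)) (R ℕ.* Q) G
  ∑∣-* G = begin
    ∑ℤ.fold (suc R) (λ x → [ x ∣R] ℤ.* ∑ℤ.fold (suc Q) (λ u → [ u ∣Q] ℤ.* G (x ℕ.* u)))
      ≡⟨ ∑ℤ.fold-cong (suc R) (λ x x≤R → ≡.cong ([ x ∣R] ℤ.*_) (∑ℤ.fold-cong (suc Q) (λ u u≤Q →
           ≡.cong ([ u ∣Q] ℤ.*_) (≡.sym (pick x u x≤R u≤Q))))) ⟩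
    ∑ℤ.fold (suc R) (λ x → [ x ∣R] ℤ.* ∑ℤ.fold (suc Q) (λ u → [ u ∣Q] ℤ.* ∑ℤ.fold (suc N) (λ d → T x u d)))
      ≡⟨ ∑ℤ.fold-cong (suc R) (λ x _ → ≡.cong ([ x ∣R] ℤ.*_) (∑ℤ.*-fold-swap (suc Q) (suc N) [_∣Q] (T x))) ⟩
    ∑ℤ.fold (suc R) (λ x → [ x ∣R] ℤ.* ∑ℤ.fold (suc N) (λ d → ∑ℤ.fold (suc Q) (λ u → [ u ∣Q] ℤ.* T x u d)))
      ≡⟨ ∑ℤ.*-fold-swap (suc R) (suc N) [_∣R] (λ x d → ∑ℤ.fold (suc Q) (λ u → [ u ∣Q] ℤ.* T x u d)) ⟩
    ∑ℤ.fold (suc N) (λ d → ∑ℤ.fold (suc R) (λ x → [ x ∣R] ℤ.* ∑ℤ.fold (suc Q) (λ u → [ u ∣Q] ℤ.* T x u d)))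
      ≡⟨ ∑ℤ.fold-cong (suc N) (λ d _ → pull-out d) ⟩
    ∑ℤ.fold (suc N) (λ d → ∑ℤ.fold (suc R) (λ x → [ x ∣R] ℤ.* count x d) ℤ.* G d)
      ≡⟨ ∑ℤ.fold-cong (suc N) (λ d _ → ≡.cong (ℤ._* G d) (≡.trans
           (∑ℤ.fold-cong (suc R) (λ x _ → charK-*-cong (x ∣? R) (λ x∣R → ∑char[d≡x*u]≡char[RPart] d x {{nonZero-∣ x∣R}})))
           (∑∣char[RPart]≡char[d∣RQ] d))) ⟩
    ∑ℤ.fold (suc N) (λ d → [ d ∣N] ℤ.* G d)
      ∎
    where
    N = R ℕ.* Q
    [_∣R] [_∣Q] [_∣N] : ℕ → ℤ
    [ x ∣R] = charℤ (x ∣? R)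
    [ u ∣Q] = charℤ (u ∣? Q)
    [ d ∣N] = charℤ (d ∣? N)
    T : ℕ → ℕ → ℕ → ℤ
    T x u d = charℤ (d ℕ.≟ x ℕ.* u) ℤ.* G d
    count : ℕ → ℕ → ℤ
    count x d = ∑ℤ.fold (suc Q) (λ u → [ u ∣Q] ℤ.* charℤ (d ℕ.≟ x ℕ.* u))
    pick : ∀ x u → x < suc R → u < suc Q → ∑ℤ.fold (suc N) (T x u) ≡ G (x ℕ.* u)
    pick x u (s≤s x≤R) (s≤s u≤Q) = ≡.trans
      (∑ℤ.fold-single (suc N) (T x u) (x ℕ.* u) (s≤s (ℕP.*-mono-≤ x≤R u≤Q))
        (λ d _ d≢xu → ≡.cong (ℤ._* G d) (charK-no (d ℕ.≟ x ℕ.* u) d≢xu)))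
      (≡.trans (≡.cong (ℤ._* G (x ℕ.* u)) (charK-yes (x ℕ.* u ℕ.≟ x ℕ.* u) ≡.refl)) (ℤP.*-identityˡ _))
    pull-out : ∀ d → ∑ℤ.fold (suc R) (λ x → [ x ∣R] ℤ.* ∑ℤ.fold (suc Q) (λ u → [ u ∣Q] ℤ.* T x u d))
                   ≡ ∑ℤ.fold (suc R) (λ x → [ x ∣R] ℤ.* count x d) ℤ.* G d
    pull-out d = ≡.sym (≡.trans (∑ℤ.*-distribʳ-fold (suc R) (G d) (λ x → [ x ∣R] ℤ.* count x d)) (∑ℤ.fold-cong (suc R) (λ x _ →
      ≡.trans (ℤP.*-assoc [ x ∣R] (count x d) (G d)) (≡.cong ([ x ∣R] ℤ.*_) (≡.trans (∑ℤ.*-distribʳ-fold (suc Q) (G d) (λ u → [ u ∣Q] ℤ.* charℤ (d ℕ.≟ x ℕ.* u)))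
        (∑ℤ.fold-cong (suc Q) (λ u _ → ℤP.*-assoc [ u ∣Q] (charℤ (d ℕ.≟ x ℕ.* u)) (G d))))))))

module IntegerDivisibility where
  open import Data.Integer.Divisibility.Signed as ℤ∣ using ()
  open ≡.≡-Reasoning

  /ℕ-exact : ∀ x k .{{_ : NonZero k}} → k ∣ ℤ.∣ x ∣ → x ≡ (x /ℕ k) ℤ.* + k
  /ℕ-exact x k k∣x = begin
    x                                         ≡⟨ a≡a%ℕn+[a/ℕn]*n x k ⟩
    + (x %ℕ k) ℤ.+ (x /ℕ k) ℤ.* + k           ≡⟨ ≡.cong (λ r → + r ℤ.+ (x /ℕ k) ℤ.* + k) x%k≡0 ⟩
    ℤ.0ℤ ℤ.+ (x /ℕ k) ℤ.* + k                 ≡⟨ ℤP.+-identityˡ _ ⟩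
    (x /ℕ k) ℤ.* + k                          ∎
    where
    k∣x%k : k ∣ x %ℕ k
    k∣x%k = ℤ∣.∣⇒∣ᵤ (ℤ∣.∣m+n∣n⇒∣m {m = + (x %ℕ k)} (≡.subst (+ k ℤ∣.∣_) (a≡a%ℕn+[a/ℕn]*n x k) (ℤ∣.∣ᵤ⇒∣ k∣x)) (ℤ∣.∣n⇒∣m*n (x /ℕ k) ℤ∣.∣-refl))
    x%k≡0 : x %ℕ k ≡ 0
    x%k≡0 with x %ℕ k | k∣x%k | n%ℕd<d x k
    ... | zero  | _   | _   = ≡.refl
    ... | suc r | k∣r | r<k = contradiction (∣⇒≤ k∣r) (ℕP.<⇒≱ r<k)

  coprime⇒*∣ : ∀ {a b c} → Coprime a b → a ∣ c → b ∣ c → a ℕ.* b ∣ c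
  coprime⇒*∣ {a} {b} a⊥b a∣c b∣c = ≡.subst (_∣ _) ab≡lcm (lcm-least a∣c b∣c)
    where
    ab≡lcm : lcm a b ≡ a ℕ.* b
    ab≡lcm = ≡.trans (≡.sym (ℕP.*-identityˡ _)) (≡.trans (≡.cong (ℕ._* lcm a b) (≡.sym (coprime⇒gcd≡1 a⊥b))) (gcd*lcm a b))

  odd⇒coprime-2 : ∀ {d n} → ¬ 2 ∣ n → d ∣ n → Coprime d 2
  odd⇒coprime-2 2∤n d∣n (i∣d , i∣2) with prime⇒irreducible prime[2] i∣2
  ... | inj₁ i≡1   = i≡1
  ... | inj₂ ≡.refl = contradiction (∣-trans i∣d d∣n) 2∤n

  -- m + n and m - n have the same parity.
  2R∣m+n : ∀ R m n → ¬ 2 ∣ R → R ∣ ℤ.∣ m ℤ.+ n ∣ → 2 ∣ ℤ.∣ m ℤ.- n ∣ → 2 ℕ.* R ∣ ℤ.∣ m ℤ.+ n ∣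
  2R∣m+n R m n 2∤R R∣x 2∣y = coprime⇒*∣ (Cop.sym (odd⇒coprime-2 2∤R ∣-refl)) 2∣x R∣x
    where
    x≡y+2n : m ℤ.+ n ≡ (m ℤ.- n) ℤ.+ + 2 ℤ.* n
    x≡y+2n = solve-x≡y+2n m n
      where
      solve-x≡y+2n : ∀ m n → m ℤ.+ n ≡ (m ℤ.- n) ℤ.+ + 2 ℤ.* n
      solve-x≡y+2n = solveℤ
    2∣x : 2 ∣ ℤ.∣ m ℤ.+ n ∣
    2∣x = ℤ∣.∣⇒∣ᵤ (≡.subst (+ 2 ℤ∣.∣_) (≡.sym x≡y+2n) (ℤ∣.∣m∣n⇒∣m+n (ℤ∣.∣ᵤ⇒∣ {i = m ℤ.- n} 2∣y) (ℤ∣.∣m⇒∣m*n n ℤ∣.∣-refl)))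

  ∣x/ℕR∣≡∣x/ℕkR∣*k : ∀ x k R .{{_ : NonZero R}} .{{_ : NonZero (k ℕ.* R)}} → k ℕ.* R ∣ ℤ.∣ x ∣ →
    ℤ.∣ x /ℕ R ∣ ≡ ℤ.∣ x /ℕ (k ℕ.* R) ∣ ℕ.* k
  ∣x/ℕR∣≡∣x/ℕkR∣*k x k R kR∣x = ≡.trans (≡.cong ℤ.∣_∣ x/R≡j*k) (ℤP.abs-* j (+ k))
    where
    j = x /ℕ (k ℕ.* R)
    x/R≡j*k : x /ℕ R ≡ j ℤ.* + k
    x/R≡j*k = ℤP.*-cancelʳ-≡ _ _ (+ R) (begin
      (x /ℕ R) ℤ.* + R        ≡⟨ /ℕ-exact x R (∣-trans (n∣m*n k) kR∣x) ⟨
      x                       ≡⟨ /ℕ-exact x (k ℕ.* R) kR∣x ⟩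
      j ℤ.* + (k ℕ.* R)       ≡⟨ ≡.cong (j ℤ.*_) (ℤP.pos-* k R) ⟩
      j ℤ.* (+ k ℤ.* + R)     ≡⟨ ℤP.*-assoc j (+ k) (+ R) ⟨
      j ℤ.* + k ℤ.* + R       ∎)

  ∣*∣s∣⇔∣*[s%ℕN] : ∀ N d s .{{_ : NonZero N}} → N ∣ d ℕ.* ℤ.∣ s ∣ ⇔ N ∣ d ℕ.* (s %ℕ N)
  ∣*∣s∣⇔∣*[s%ℕN] N d s = mk⇔
    (λ N∣ds → ℤ∣.∣⇒∣ᵤ (ℤ∣.∣m+n∣n⇒∣m {m = + (d ℕ.* (s %ℕ N))} (≡.subst (+ N ℤ∣.∣_) ds≡ (ℤ∣.∣ᵤ⇒∣ (≡.subst (N ∣_) (≡.sym ∣ds∣) N∣ds))) N∣qN))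
    (λ N∣ds′ → ≡.subst (N ∣_) ∣ds∣ (ℤ∣.∣⇒∣ᵤ (≡.subst (+ N ℤ∣.∣_) (≡.sym ds≡) (ℤ∣.∣m∣n⇒∣m+n (ℤ∣.∣ᵤ⇒∣ {i = + (d ℕ.* (s %ℕ N))} N∣ds′) N∣qN))))
    where
    q = + d ℤ.* (s /ℕ N)
    ds≡ : + d ℤ.* s ≡ + (d ℕ.* (s %ℕ N)) ℤ.+ q ℤ.* + N
    ds≡ = begin
      + d ℤ.* s                                               ≡⟨ ≡.cong (+ d ℤ.*_) (a≡a%ℕn+[a/ℕn]*n s N) ⟩
      + d ℤ.* (+ (s %ℕ N) ℤ.+ (s /ℕ N) ℤ.* + N)               ≡⟨ distrib (+ d) (+ (s %ℕ N)) (s /ℕ N) (+ N) ⟩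
      + d ℤ.* + (s %ℕ N) ℤ.+ q ℤ.* + N                        ≡⟨ ≡.cong (ℤ._+ q ℤ.* + N) (ℤP.pos-* d (s %ℕ N)) ⟨
      + (d ℕ.* (s %ℕ N)) ℤ.+ q ℤ.* + N                        ∎
      where
      distrib : ∀ a b c e → a ℤ.* (b ℤ.+ c ℤ.* e) ≡ a ℤ.* b ℤ.+ (a ℤ.* c) ℤ.* e
      distrib = solveℤ
    ∣ds∣ : ℤ.∣ + d ℤ.* s ∣ ≡ d ℕ.* ℤ.∣ s ∣
    ∣ds∣ = ℤP.abs-* (+ d) s
    N∣qN : + N ℤ∣.∣ q ℤ.* + N
    N∣qN = ℤ∣.∣n⇒∣m*n q ℤ∣.∣-refl

module RightHandSide (R Q : ℕ) .{{_ : NonZero R}} .{{_ : NonZero Q}} (m n : ℤ) where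
  open DivisorSums using (∑∣)
  open FactorisationSums
  open Indicator ℤP.+-*-commutativeRing using (charK-cong)
  open ≡.≡-Reasoning

  private
    instance _ = ℕP.m*n≢0 2 Q
    instance _ = ℕP.m*n≢0 R Q

  U Y : ℕ
  U = ℤ.∣ (m ℤ.+ n) /ℕ R ∣
  Y = ℤ.∣ (m ℤ.- n) /ℕ (2 ℕ.* Q) ∣

  term : ℕ → ℕ → ℕ → ℕ → ℤ
  term R₁ R₂ Q₁ Q₂ = μ (R₁ ℕ.* Q₁) ℤ.* charℤ ((R₁ ℕ.* Q₁) ∣? U) ℤ.* charℤ ((R₂ ℕ.* Q₂) ∣? Y)

  sum : ℤ
  sum = sumℤ (map (λ r → sumℤ (map (λ q → term (proj₁ r) (proj₂ r) (proj₁ q) (proj₂ q)) (factorizations Q))) (factorizations R))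

  divisorTerm : ℕ → ℤ
  divisorTerm d = μ d ℤ.* charℤ (d ∣? U) ℤ.* charℤ (R ℕ.* Q ∣? d ℕ.* Y)

  -- Since R Q = (R₁ Q₁)(R₂ Q₂), the last factor of the term only depends on d = R₁ Q₁.
  term≡divisorTerm : ∀ R₁ R₂ Q₁ Q₂ → R₁ ℕ.* R₂ ≡ R → Q₁ ℕ.* Q₂ ≡ Q → term R₁ R₂ Q₁ Q₂ ≡ divisorTerm (R₁ ℕ.* Q₁)
  term≡divisorTerm R₁ R₂ Q₁ Q₂ R₁R₂≡R Q₁Q₂≡Q =
    ≡.cong (μ (R₁ ℕ.* Q₁) ℤ.* charℤ ((R₁ ℕ.* Q₁) ∣? U) ℤ.*_)
      (charK-cong ((R₂ ℕ.* Q₂) ∣? Y) (R ℕ.* Q ∣? (R₁ ℕ.* Q₁) ℕ.* Y)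
        (mk⇔ (λ R₂Q₂∣Y → ≡.subst (_∣ (R₁ ℕ.* Q₁) ℕ.* Y) (≡.sym RQ≡) (*-monoʳ-∣ (R₁ ℕ.* Q₁) R₂Q₂∣Y))
             (λ RQ∣d*Y → *-cancelˡ-∣ (R₁ ℕ.* Q₁) {{R₁Q₁≢0}} (≡.subst (_∣ (R₁ ℕ.* Q₁) ℕ.* Y) RQ≡ RQ∣d*Y))))
    where
    RQ≡ : R ℕ.* Q ≡ (R₁ ℕ.* Q₁) ℕ.* (R₂ ℕ.* Q₂)
    RQ≡ = ≡.trans (≡.cong₂ ℕ._*_ (≡.sym R₁R₂≡R) (≡.sym Q₁Q₂≡Q)) (interchange R₁ R₂ Q₁ Q₂)
      where
      interchange : ∀ a b c d → (a ℕ.* b) ℕ.* (c ℕ.* d) ≡ (a ℕ.* c) ℕ.* (b ℕ.* d)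
      interchange = solveℕ
    R₁Q₁≢0 : NonZero (R₁ ℕ.* Q₁)
    R₁Q₁≢0 = nonZero-∣ (divides (R₂ ℕ.* Q₂) (≡.trans RQ≡ (ℕP.*-comm (R₁ ℕ.* Q₁) (R₂ ℕ.* Q₂))))

  sum≡∑∣divisorTerm : SquareFree (R ℕ.* Q) → sum ≡ ∑∣ (suc (R ℕ.* Q)) (R ℕ.* Q) divisorTerm
  sum≡∑∣divisorTerm sf = begin
    sum
      ≡⟨ sumℤ-factorizations-cong R (λ R₁ R₂ R₁R₂≡R → sumℤ-factorizations-cong Q (λ Q₁ Q₂ Q₁Q₂≡Q →
           term≡divisorTerm R₁ R₂ Q₁ Q₂ R₁R₂≡R Q₁Q₂≡Q)) ⟩
    sumℤ (map (λ r → sumℤ (map (λ q → divisorTerm (proj₁ r ℕ.* proj₁ q)) (factorizations Q))) (factorizations R))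
      ≡⟨ sumℤ-factorizations-proj₁ R (λ x → sumℤ (map (λ q → divisorTerm (x ℕ.* proj₁ q)) (factorizations Q))) ⟩
    ∑∣ (suc R) R (λ x → sumℤ (map (λ q → divisorTerm (x ℕ.* proj₁ q)) (factorizations Q)))
      ≡⟨ ∑ℤ.fold-cong (suc R) (λ x _ → ≡.cong (charℤ (x ∣? R) ℤ.*_) (sumℤ-factorizations-proj₁ Q (λ u → divisorTerm (x ℕ.* u)))) ⟩
    ∑∣ (suc R) R (λ x → ∑∣ (suc Q) Q (λ u → divisorTerm (x ℕ.* u)))
      ≡⟨ CoprimeDivisorSums.∑∣-* R Q (SquareFree[m*n]⇒coprime sf) divisorTerm ⟩
    ∑∣ (suc (R ℕ.* Q)) (R ℕ.* Q) divisorTerm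
      ∎

  ∑∣divisorTerm≡fClosed : ∀ J s′ → (∀ d → d ∣ R ℕ.* Q → d ∣ U ⇔ d ∣ J) → (∀ d → R ℕ.* Q ∣ d ℕ.* Y ⇔ R ℕ.* Q ∣ d ℕ.* s′) →
    ∑∣ (suc (R ℕ.* Q)) (R ℕ.* Q) divisorTerm ≡ fClosed (R ℕ.* Q) J s′
  ∑∣divisorTerm≡fClosed J s′ U⇔J Y⇔s′ = ∑ℤ.fold-cong (suc N) (λ d _ → by-cases d (d ∣? N))
    where
    N = R ℕ.* Q
    by-cases : ∀ d (d∣?N : Dec (d ∣ N)) →
      charℤ d∣?N ℤ.* divisorTerm d ≡ ((charℤ (d ∣? J) ℤ.* charℤ d∣?N) ℤ.* μ d) ℤ.* charℤ (N ∣? d ℕ.* s′)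
    by-cases d (no _)    = ≡.cong (λ c → c ℤ.* μ d ℤ.* charℤ (N ∣? d ℕ.* s′)) (≡.sym (ℤP.*-zeroʳ (charℤ (d ∣? J))))
    by-cases d (yes d∣N) = ≡.trans
      (≡.cong₂ (λ cU cY → ℤ.1ℤ ℤ.* (μ d ℤ.* cU ℤ.* cY)) (charK-cong (d ∣? U) (d ∣? J) (U⇔J d d∣N))
                                                       (charK-cong (N ∣? d ℕ.* Y) (N ∣? d ℕ.* s′) (Y⇔s′ d)))
      (reorder (μ d) (charℤ (d ∣? J)) (charℤ (N ∣? d ℕ.* s′)))
      where
      reorder : ∀ μ cJ cS → ℤ.1ℤ ℤ.* (μ ℤ.* cJ ℤ.* cS) ≡ ((cJ ℤ.* ℤ.1ℤ) ℤ.* μ) ℤ.* cS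
      reorder = solveℤ

module MainTerm {c ℓ} (K : CommutativeRing c ℓ) (R Q : ℕ) .{{_ : NonZero R}} .{{_ : NonZero Q}} where
  open CommutativeRing K
  open Over K
  open ExponentialSum K using (f≈ι[fClosed])
  open DivisorSums using (∑∣)
  open IntegerDivisibility using (∣x/ℕR∣≡∣x/ℕkR∣*k; odd⇒coprime-2; ∣*∣s∣⇔∣*[s%ℕN])
  open import Relation.Binary.Reasoning.Setoid setoid

  private
    instance _ = ℕP.m*n≢0 R Q
    instance _ = ℕP.m*n≢0 2 R
    instance _ = ℕP.m*n≢0 2 Q

  f≈ι[sum] : SquareFree (R ℕ.* Q) → ¬ 2 ∣ R ℕ.* Q → NoZeroDivisors →
    ∀ ζ Ninv → PrimitiveRoot (R ℕ.* Q) ζ → IsInverseOf (R ℕ.* Q) Ninv → ∀ m n → 2 ℕ.* R ∣ ℤ.∣ m ℤ.+ n ∣ →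
    f (R ℕ.* Q) ζ Ninv ((m ℤ.+ n) /ℕ (2 ℕ.* R)) ((m ℤ.- n) /ℕ (2 ℕ.* Q)) ≈ ι (RightHandSide.sum R Q m n)
  f≈ι[sum] sf 2∤N nzd ζ Ninv prim N·Ninv≈1 m n 2R∣m+n = begin
    f N ζ Ninv j s                  ≈⟨ f≈ι[fClosed] N ζ Ninv j s sf nzd prim N·Ninv≈1 ⟩
    ι (fClosed N ℤ.∣ j ∣ (s %ℕ N))  ≡⟨ ≡.cong ι (∑∣divisorTerm≡fClosed ℤ.∣ j ∣ (s %ℕ N) U⇔J (λ d → ∣*∣s∣⇔∣*[s%ℕN] N d s)) ⟨
    ι (∑∣ (suc N) N divisorTerm)    ≡⟨ ≡.cong ι (sum≡∑∣divisorTerm sf) ⟨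
    ι sum                           ∎
    where
    open RightHandSide R Q m n using (U; sum; divisorTerm; sum≡∑∣divisorTerm; ∑∣divisorTerm≡fClosed)
    N = R ℕ.* Q
    j = (m ℤ.+ n) /ℕ (2 ℕ.* R)
    s = (m ℤ.- n) /ℕ (2 ℕ.* Q)
    U≡2J : U ≡ 2 ℕ.* ℤ.∣ j ∣
    U≡2J = ≡.trans (∣x/ℕR∣≡∣x/ℕkR∣*k (m ℤ.+ n) 2 R 2R∣m+n) (ℕP.*-comm ℤ.∣ j ∣ 2)
    U⇔J : ∀ d → d ∣ N → d ∣ U ⇔ d ∣ ℤ.∣ j ∣
    U⇔J d d∣N = mk⇔ (λ d∣U → coprime-divisor (odd⇒coprime-2 2∤N d∣N) (≡.subst (d ∣_) U≡2J d∣U))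
                    (λ d∣J → ≡.subst (d ∣_) (≡.sym U≡2J) (∣n⇒∣m*n 2 d∣J))

open import Data.Nat using (_*_)

lemma7p1 : ∀ {c ℓ : Level} (K : CommutativeRing c ℓ)
    (R Q : ℕ) .{{_ : NonZero R}} .{{_ : NonZero Q}} →
    SquareFree (R * Q) → ¬ (2 ∣ R * Q) →
    Over.NoZeroDivisors K →
    (ζ Ninv : CommutativeRing.Carrier K) →
    Over.PrimitiveRoot K (R * Q) ζ → Over.IsInverseOf K (R * Q) Ninv →
    (m n : ℤ) →
    CommutativeRing._≈_ K (Over.c-RQ K R Q ζ Ninv m n) (Over.ι K (rhs R Q m n))
lemma7p1 K R Q sf 2∤RQ nzd ζ Ninv prim N·Ninv≈1 m n = begin
  charK (R ∣ℤ? x) K.* charK ((2 ℕ.* Q) ∣ℤ? y) K.* F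
    ≈⟨ K.*-cong (charK-cong-* (R ∣ℤ? x) ((2 ℕ.* R) ∣ℤ? x) ((2 ℕ.* Q) ∣ℤ? y) R∣x⇔2R∣x) K.refl ⟩
  charK ((2 ℕ.* R) ∣ℤ? x) K.* charK ((2 ℕ.* Q) ∣ℤ? y) K.* F
    ≈⟨ charK-*-*-cong ((2 ℕ.* R) ∣ℤ? x) _ (f≈ι[sum] sf 2∤RQ nzd ζ Ninv prim N·Ninv≈1 m n) ⟩
  charK ((2 ℕ.* R) ∣ℤ? x) K.* charK ((2 ℕ.* Q) ∣ℤ? y) K.* ι sum
    ≈⟨ ι-charℤ-*-charℤ-* ((2 ℕ.* R) ∣ℤ? x) ((2 ℕ.* Q) ∣ℤ? y) sum ⟨
  ι (rhs R Q m n)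
    ∎
  where
  module K = CommutativeRing K
  open Over K using (charK; ι; f)
  open Indicator K using (charK-cong-*; charK-*-*-cong)
  open IntegerEmbedding K using (ι-charℤ-*-charℤ-*)
  open MainTerm K R Q using (f≈ι[sum])
  open RightHandSide R Q m n using (sum)
  open import Relation.Binary.Reasoning.Setoid K.setoid
  instance _ = ℕP.m*n≢0 R Q
  instance _ = ℕP.m*n≢0 2 R
  instance _ = ℕP.m*n≢0 2 Q
  x = m ℤ.+ n
  y = m ℤ.- n
  F : K.Carrier
  F = f (R * Q) ζ Ninv (x /ℕ (2 ℕ.* R)) (y /ℕ (2 ℕ.* Q))
  R∣x⇔2R∣x : 2 ℕ.* Q ∣ ℤ.∣ y ∣ → R ∣ ℤ.∣ x ∣ ⇔ 2 ℕ.* R ∣ ℤ.∣ x ∣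
  R∣x⇔2R∣x 2Q∣y = mk⇔ (λ R∣x → IntegerDivisibility.2R∣m+n R m n (2∤RQ ∘ ∣m⇒∣m*n Q) R∣x (∣-trans (m∣m*n Q) 2Q∣y))
                      (∣-trans (n∣m*n 2))
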